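{- Consider either (a) for a fixed $n\ge 3$, the parametric triplet distance $d^{(p)}$ on the set of all rooted phylogenies over $[n]$, or (b) for a fixed $n\ge 4$, the parametric quartet distance $d^{(p)}$ on the set of all unrooted phylogenies over $[n]$. Then: (i) for $p=0$, $d^{(p)}$ is not a distance measure; (ii) for $p\in(0,1/2)$, $d^{(p)}$ is a distance measure but not a metric; (iii) for $p\in[1/2,1]$, $d^{(p)}$ is a metric; (iv) for $p\in(0,1/2)$, $d^{(p)}$ is a near-metric, with a constant $c$ that does not depend on $n$.
   Context: Rooted phylogeny over $S$: rooted tree with leaf set $S$, every internal node having at least two children (up to label-preserving isomorphism); an internal node is resolved if it has exactly two children. Unrooted phylogeny over $S$: unrooted tree with leaf set $S$, every internal node of degree at least $3$; an internal node is resolved if it has degree exactly $3$. A tree is fully resolved if all its internal nodes are resolved. For $X\subseteq S$, $T|X$ is obtained from the minimal subtree of $T$ containing $X$ by suppressing degree-two nodes (except the root in the rooted case). A triplet (quartet) is a 3-element (4-element) subset of $S$; it is resolved in $T$ if $T|X$ is fully resolved. In the rooted (resp. unrooted) case, with triplets (resp. quartets) as the units: $\mathcal{D}(T_1,T_2)$ is the set of units $X$ with $T_1|X,T_2|X$ fully resolved and different; $\mathcal{R}_1(T_1,T_2)$ the set of units resolved in $T_1$ but not $T_2$; $\mathcal{R}_2(T_1,T_2)$ the set resolved in $T_2$ but not $T_1$; and for $p\in[0,1]$, $d^{(p)}(T_1,T_2)=|\mathcal{D}(T_1,T_2)|+p(|\mathcal{R}_1(T_1,T_2)|+|\mathcal{R}_2(T_1,T_2)|)$.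 A distance measure on a set $D$ is a function $d:D\times D\to\mathbb{R}$ with $d(x,y)\ge0$, $d(x,y)=d(y,x)$, and $d(x,y)=0$ iff $x=y$. A metric is a distance measure satisfying the triangle inequality. A distance measure $d$ is a near-metric if there is a constant $c$, independent of the size of $D$, such that $d(x,z)\le c\,(d(x,x_1)+d(x_1,x_2)+\dots+d(x_{m-1},z))$ for all $m>1$ and all $x,z,x_1,\dots,x_{m-1}\in D$.
   Formalization: The parameter p ranges over the rationals rather than the reals in parts (ii)–(iv). -}

module Defs where

open import Data.Bool using (Bool; true; false; _∧_; not)
import Data.Bool as B
open import Data.Nat using (ℕ; zero; suc; _≡ᵇ_)
open import Data.Fin using (Fin)
open import Data.Fin.Subset using (Subset; _∩_; ∁; ⊤; ⊥; ⁅_⁆; ∣_∣; _⊆_; Empty)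
open import Data.Vec using (Vec; []; _∷_)
open import Data.Vec.Properties using (≡-dec)
open import Data.List using (List; []; _∷_; _++_; map; filter; length)
open import Data.Bool.ListAction using (any)
open import Data.Integer using (+_)
open import Data.Rational using (ℚ; _+_; _*_; _/_; _≤_; 0ℚ)
open import Data.Product using (_×_; Σ; ∃)
open import Data.Sum using (_⊎_)
open import Relation.Binary.PropositionalEquality using (_≡_)
open import Relation.Nullary using (¬_; ⌊_⌋)
open import Relation.Nullary.Decidable using (T?)
open import Function.Bundles using (_⇔_)

allSubsets : (n : ℕ) → List (Subset n)
allSubsets zero    = [] ∷ []
allSubsets (suc n) = map (true ∷_) (allSubsets n) ++ map (false ∷_) (allSubsets n)

_=ˢ_ : ∀ {n} → Subset n → Subset n → Bool
A =ˢ B = ⌊ ≡-dec B._≟_ A B ⌋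

kSubsets : (k n : ℕ) → List (Subset n)
kSubsets k n = filter (λ X → T? (∣ X ∣ ≡ᵇ k)) (allSubsets n)

count : ∀ {A : Set} → (A → Bool) → List A → ℕ
count f xs = length (filter (λ x → T? (f x)) xs)

ℕtoℚ : ℕ → ℚ
ℕtoℚ m = + m / 1

-- Rooted phylogenies over [n], represented by their set of clusters
-- (a hierarchy).  A cluster of a node v is the set of leaves below v.

record Rooted (n : ℕ) : Set where
  field
    cl      : Subset n → Bool
    full    : cl ⊤ ≡ true
    single  : ∀ i → cl ⁅ i ⁆ ≡ true
    nonempt : cl ⊥ ≡ false
    laminar : ∀ A B → cl A ≡ true → cl B ≡ true →
              A ⊆ B ⊎ B ⊆ A ⊎ Empty (A ∩ B)
open Rooted public

-- Unrooted phylogenies over [n], represented by their set of splits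
-- (edge bipartitions).  A split {A, ∁A} is represented by both sides,
-- i.e. the characteristic function is closed under complement.
record Unrooted (n : ℕ) : Set where
  field
    sp      : Subset n → Bool
    symm    : ∀ A → sp A ≡ sp (∁ A)
    nonempt : sp ⊥ ≡ false
    trivial : ∀ i → sp ⁅ i ⁆ ≡ true
    compat  : ∀ A B → sp A ≡ true → sp B ≡ true →
              Empty (A ∩ B) ⊎ Empty (A ∩ ∁ B) ⊎ Empty (∁ A ∩ B) ⊎ Empty (∁ A ∩ ∁ B)
open Unrooted public

-- Equality of phylogenies (label-preserving isomorphism) = same cluster /
-- split set.
_≈R_ : ∀ {n} → Rooted n → Rooted n → Set
T₁ ≈R T₂ = ∀ C → cl T₁ C ≡ cl T₂ C

_≈U_ : ∀ {n} → Unrooted n → Unrooted n → Set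
T₁ ≈U T₂ = ∀ C → sp T₁ C ≡ sp T₂ C

-- For a cluster system (rooted) T|X with |X| = 3 is fully resolved iff some
-- cluster contains exactly two elements of X, and then T|X is the triplet
-- with that cherry.  For a split system (unrooted) T|X with |X| = 4 is fully
-- resolved iff some split separates X into 2|2, and then T|X is the quartet
-- with that split.  In both cases: "some C in the system with |C ∩ X| = 2",
-- and the topology is determined by C ∩ X (split systems are closed under
-- complement, so comparing one side suffices).

module _ {n : ℕ} where

  resolvedIn : (Subset n → Bool) → Subset n → Bool
  resolvedIn S X = any (λ C → S C ∧ (∣ C ∩ X ∣ ≡ᵇ 2)) (allSubsets n)

  sameTopology : (Subset n → Bool) → (Subset n → Bool) → Subset n → Bool
  sameTopology S₁ S₂ X =
    any (λ C → S₁ C ∧ (∣ C ∩ X ∣ ≡ᵇ 2) ∧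
               any (λ C′ → S₂ C′ ∧ ((C′ ∩ X) =ˢ (C ∩ X))) (allSubsets n))
        (allSubsets n)

  #D : ℕ → (Subset n → Bool) → (Subset n → Bool) → ℕ
  #D k S₁ S₂ = count (λ X → resolvedIn S₁ X ∧ resolvedIn S₂ X ∧ not (sameTopology S₁ S₂ X))
                     (kSubsets k n)

  #R₁ : ℕ → (Subset n → Bool) → (Subset n → Bool) → ℕ
  #R₁ k S₁ S₂ = count (λ X → resolvedIn S₁ X ∧ not (resolvedIn S₂ X)) (kSubsets k n)

  #R₂ : ℕ → (Subset n → Bool) → (Subset n → Bool) → ℕ
  #R₂ k S₁ S₂ = #R₁ k S₂ S₁

  dpar : ℕ → ℚ → (Subset n → Bool) → (Subset n → Bool) → ℚ
  dpar k p S₁ S₂ = ℕtoℚ (#D k S₁ S₂) + p * (ℕtoℚ (#R₁ k S₁ S₂) + ℕtoℚ (#R₂ k S₁ S₂))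

dTriplet : ∀ {n} → ℚ → Rooted n → Rooted n → ℚ
dTriplet p T₁ T₂ = dpar 3 p (cl T₁) (cl T₂)

dQuartet : ∀ {n} → ℚ → Unrooted n → Unrooted n → ℚ
dQuartet p T₁ T₂ = dpar 4 p (sp T₁) (sp T₂)

module _ {A : Set} (_≈_ : A → A → Set) (d : A → A → ℚ) where

  IsDistanceMeasure : Set
  IsDistanceMeasure =
    (∀ x y → 0ℚ ≤ d x y) ×
    (∀ x y → d x y ≡ d y x) ×
    (∀ x y → (d x y ≡ 0ℚ) ⇔ (x ≈ y))

  IsMetric : Set
  IsMetric = IsDistanceMeasure × (∀ x y z → d x z ≤ d x y + d y z)

  pathLength : A → List A → A → ℚ
  pathLength x []       z = d x z
  pathLength x (y ∷ ys) z = d x y + pathLength y ys z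

  -- near-metric inequality with the given constant c (m > 1, i.e. at least
  -- one intermediate point x₁)
  NearMetricWith : ℚ → Set
  NearMetricWith c = IsDistanceMeasure ×
    (∀ x x₁ (xs : List A) z → d x z ≤ c * pathLength x (x₁ ∷ xs) z)

{-# OPTIONS --safe #-}
-- Both distances are sums, over all units X (triplets, resp. quartets), of a cost that is
-- 1 if T₁|X and T₂|X are resolved differently, p if exactly one of them is resolved and
-- 0 otherwise, so every property can be checked unit by unit.  Agreement on a unit is
-- transitive because a unit has at most one resolution in a tree, and trees agreeing on
-- all units are equal because every cluster (split) C of T₁ is rebuilt in T₂ from the
-- cherries {a,b} of the units {a,b,x} (resp. {a,b,c,d}) with a,b ∈ C and x,c,d ∉ C.
-- Hence d⁽ᵖ⁾ is a distance measure for p > 0, and for p ≥ ½ the triangle inequality holds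
-- on each unit since 1 ≤ p + p.  On a path from x to z, a unit on which x and z disagree
-- costs at most 1 in d(x,z) and at least p at some step of the path, so 1/p is a
-- near-metric constant for every n.  Conversely, the star S resolves no unit: for the
-- trees P, Q whose only nontrivial cluster (split) is {0,1}, resp. {0,2}, we get
-- d⁽⁰⁾(P,S) = 0 although P ≠ S, and for p < ½ each unit resolved by both P and Q (such
-- as {0,1,2}, resp. {0,1,2,3}) costs 1 > p + p, so d(P,S) + d(S,Q) < d(P,Q).
module Submission where

open import Defs
open import Data.Bool using (Bool; true; false; T; _∧_; not; if_then_else_; _≟_)
open import Data.Bool.Properties using (¬-not; T-≡; not-involutive)
open import Data.Bool.ListAction using (any)
open import Data.Nat as ℕ using (ℕ; suc) renaming (_≤_ to _≤ℕ_)
import Data.Nat.Properties as ℕP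
import Data.Integer as ℤ
open import Data.Integer.Solver using (module +-*-Solver)
open import Data.Rational
  using (ℚ; _≤_; _<_; 0ℚ; 1ℚ; ½; _+_; _*_; 1/_; toℚᵘ; nonNegative; positive; NonNegative; Positive; NonZero)
import Data.Rational.Properties as ℚP
import Data.Rational.Unnormalised as ℚᵘ
import Data.Rational.Unnormalised.Properties as ℚᵘP
open import Algebra.Bundles using (CommutativeMonoid)
open import Algebra.Properties.CommutativeSemigroup
  (CommutativeMonoid.commutativeSemigroup ℚP.+-0-commutativeMonoid) using (interchange)
open import Data.Fin using (Fin)
import Data.Fin.Properties as FinP
open import Data.Fin.Subset using (Subset; _∈_; _∉_; _⊆_; _∩_; _∪_; ∁; ⁅_⁆; ⊤; ⊥; ∣_∣; Empty; Nonempty)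
import Data.Fin.Subset.Properties as SubsetP
open import Data.Vec using ([]; _∷_)
import Data.Vec as Vec
open import Data.Vec.Properties using (≡-dec; map-∘; map-cong; map-id)
open import Data.List using (List; []; _∷_; _++_; map; filter; length; allFin)
import Data.List.Properties as ListP
open import Data.List.Membership.Propositional using (find; lose) renaming (_∈_ to _∈ˡ_)
open import Data.List.Membership.Propositional.Properties
  using (∈-++⁺ˡ; ∈-++⁺ʳ; ∈-++⁻; ∈-map⁺; ∈-map⁻; ∈-filter⁺; ∈-filter⁻; ∈-allFin)
open import Data.List.Relation.Unary.Any using (here; there)
open import Data.List.Relation.Unary.Any.Properties using (any⁺; any⁻)
open import Data.Product using (_×_; _,_; proj₁; proj₂; ∃)
open import Data.Sum using (_⊎_; inj₁; inj₂; [_,_]′; swap)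
open import Function.Bundles using (Equivalence; mk⇔)
open import Relation.Binary.PropositionalEquality
open import Relation.Nullary using (¬_; yes; no; Dec; ¬?)
open import Data.Empty using (⊥-elim)
open import Function using (case_of_; _∘′_)
open import Relation.Nullary.Decidable using (T?; _×-dec_)

private
  variable
    A : Set
    n : ℕ

true⇔true⇒≡ : ∀ {a b} → (a ≡ true → b ≡ true) → (b ≡ true → a ≡ true) → a ≡ b
true⇔true⇒≡ {true}  a⇒b _   = sym (a⇒b refl)
true⇔true⇒≡ {false} {false} _ _ = refl
true⇔true⇒≡ {false} {true}  _ b⇒a = b⇒a refl

∧-true⁻ : ∀ {a b} → a ∧ b ≡ true → a ≡ true × b ≡ true
∧-true⁻ {true} b≡true = refl , b≡true

≡ᵇ-true⇒≡ : ∀ {m k} → (m ℕ.≡ᵇ k) ≡ true → m ≡ k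
≡ᵇ-true⇒≡ {m} {k} e = ℕP.≡ᵇ⇒≡ m k (Equivalence.from T-≡ e)

≡⇒≡ᵇ-true : ∀ {m k} → m ≡ k → (m ℕ.≡ᵇ k) ≡ true
≡⇒≡ᵇ-true {m} {k} e = Equivalence.to T-≡ (ℕP.≡⇒≡ᵇ m k e)

any-true⇒∃ : (f : A → Bool) (xs : List A) → any f xs ≡ true → ∃ λ x → x ∈ˡ xs × f x ≡ true
any-true⇒∃ f xs e with find (any⁻ f xs (Equivalence.from T-≡ e))
... | x , x∈xs , fx = x , x∈xs , Equivalence.to T-≡ fx

∈⇒any-true : (f : A → Bool) {xs : List A} {x : A} → x ∈ˡ xs → f x ≡ true → any f xs ≡ true
∈⇒any-true f x∈xs fx = Equivalence.to T-≡ (any⁺ f (lose x∈xs (Equivalence.from T-≡ fx)))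

=ˢ-true⇒≡ : {C D : Subset n} → (C =ˢ D) ≡ true → C ≡ D
=ˢ-true⇒≡ {C = C} {D} e with ≡-dec _≟_ C D
... | yes C≡D = C≡D

≡⇒=ˢ-true : {C D : Subset n} → C ≡ D → (C =ˢ D) ≡ true
≡⇒=ˢ-true {C = C} {D} C≡D with ≡-dec _≟_ C D
... | yes _   = refl
... | no C≢D = ⊥-elim (C≢D C≡D)

∈-allSubsets : (C : Subset n) → C ∈ˡ allSubsets n
∈-allSubsets []            = here refl
∈-allSubsets (true  ∷ C)   = ∈-++⁺ˡ (∈-map⁺ (true ∷_) (∈-allSubsets C))
∈-allSubsets {suc n} (false ∷ C) = ∈-++⁺ʳ (map (true ∷_) (allSubsets n)) (∈-map⁺ (false ∷_) (∈-allSubsets C))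

∈-kSubsets⁺ : ∀ {k} (X : Subset n) → ∣ X ∣ ≡ k → X ∈ˡ kSubsets k n
∈-kSubsets⁺ {k = k} X ∣X∣≡k = ∈-filter⁺ (λ X → T? (∣ X ∣ ℕ.≡ᵇ k)) (∈-allSubsets X) (ℕP.≡⇒≡ᵇ _ k ∣X∣≡k)

∈-kSubsets⁻ : ∀ {k} {X : Subset n} → X ∈ˡ kSubsets k n → ∣ X ∣ ≡ k
∈-kSubsets⁻ {n} {k} X∈ = ℕP.≡ᵇ⇒≡ _ k (proj₂ (∈-filter⁻ (λ X → T? (∣ X ∣ ℕ.≡ᵇ k)) {xs = allSubsets n} X∈))

sumℚ : (A → ℚ) → List A → ℚ
sumℚ f []       = 0ℚ
sumℚ f (x ∷ xs) = f x + sumℚ f xs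

indicator : Bool → ℚ
indicator b = if b then 1ℚ else 0ℚ

ℕtoℚ-suc : ∀ m → ℕtoℚ (suc m) ≡ 1ℚ + ℕtoℚ m
ℕtoℚ-suc m = ℚP.toℚᵘ-injective (begin
  toℚᵘ (ℕtoℚ (suc m))               ≈⟨ ℚP.toℚᵘ-fromℚᵘ (ℚᵘ.mkℚᵘ (ℤ.+ suc m) 0) ⟩
  ℚᵘ.mkℚᵘ (ℤ.+ suc m) 0             ≈⟨ ℚᵘ.*≡* (cross-multiplied (ℤ.+ m)) ⟩
  ℚᵘ.1ℚᵘ ℚᵘ.+ ℚᵘ.mkℚᵘ (ℤ.+ m) 0     ≈⟨ ℚᵘP.+-congʳ ℚᵘ.1ℚᵘ (ℚᵘP.≃-sym (ℚP.toℚᵘ-fromℚᵘ (ℚᵘ.mkℚᵘ (ℤ.+ m) 0))) ⟩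
  toℚᵘ 1ℚ ℚᵘ.+ toℚᵘ (ℕtoℚ m)        ≈⟨ ℚᵘP.≃-sym (ℚP.toℚᵘ-homo-+ 1ℚ (ℕtoℚ m)) ⟩
  toℚᵘ (1ℚ + ℕtoℚ m)                ∎)
  where
  open ℚᵘP.≃-Reasoning
  open +-*-Solver using (solve; con; _:+_; _:*_; _:=_)
  cross-multiplied : ∀ x → (ℤ.+ 1 ℤ.+ x) ℤ.* ℤ.+ 1 ≡ (ℤ.+ 1 ℤ.* ℤ.+ 1 ℤ.+ x ℤ.* ℤ.+ 1) ℤ.* ℤ.+ 1
  cross-multiplied = solve 1 (λ x → (one :+ x) :* one := (one :* one :+ x :* one) :* one) refl
    where one = con (ℤ.+ 1)

count-∷ : (f : A → Bool) (x : A) (xs : List A) → ℕtoℚ (count f (x ∷ xs)) ≡ indicator (f x) + ℕtoℚ (count f xs)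
count-∷ f x xs = by-value (f x) refl
  where
  by-value : ∀ b → f x ≡ b → ℕtoℚ (count f (x ∷ xs)) ≡ indicator (f x) + ℕtoℚ (count f xs)
  by-value true fx = begin
    ℕtoℚ (count f (x ∷ xs))   ≡⟨ cong (λ ys → ℕtoℚ (length ys))
                                      (ListP.filter-accept (λ y → T? (f y)) (Equivalence.from T-≡ fx)) ⟩
    ℕtoℚ (suc (count f xs))   ≡⟨ ℕtoℚ-suc (count f xs) ⟩
    1ℚ + ℕtoℚ (count f xs)    ≡⟨ cong (λ b → indicator b + ℕtoℚ (count f xs)) fx ⟨
    indicator (f x) + ℕtoℚ (count f xs) ∎
    where open ≡-Reasoning
  by-value false fx = begin
    ℕtoℚ (count f (x ∷ xs))   ≡⟨ cong (λ ys → ℕtoℚ (length ys)) (ListP.filter-reject (λ y → T? (f y)) (subst T fx)) ⟩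
    ℕtoℚ (count f xs)         ≡⟨ ℚP.+-identityˡ _ ⟨
    0ℚ + ℕtoℚ (count f xs)    ≡⟨ cong (λ b → indicator b + ℕtoℚ (count f xs)) fx ⟨
    indicator (f x) + ℕtoℚ (count f xs) ∎
    where open ≡-Reasoning

count≡sum-indicator : (f : A → Bool) (xs : List A) → ℕtoℚ (count f xs) ≡ sumℚ (λ x → indicator (f x)) xs
count≡sum-indicator f []       = refl
count≡sum-indicator f (x ∷ xs) = trans (count-∷ f x xs) (cong (indicator (f x) +_) (count≡sum-indicator f xs))

module _ {f g : A → ℚ} where

  sum-+ : ∀ xs → sumℚ (λ x → f x + g x) xs ≡ sumℚ f xs + sumℚ g xs
  sum-+ []       = refl
  sum-+ (x ∷ xs) = trans (cong ((f x + g x) +_) (sum-+ xs)) (interchange (f x) (g x) (sumℚ f xs) (sumℚ g xs))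

  sum-cong : ∀ xs → (∀ x → x ∈ˡ xs → f x ≡ g x) → sumℚ f xs ≡ sumℚ g xs
  sum-cong []       _   = refl
  sum-cong (x ∷ xs) f≡g = cong₂ _+_ (f≡g x (here refl)) (sum-cong xs (λ y y∈ → f≡g y (there y∈)))

  sum-mono-≤ : ∀ xs → (∀ x → x ∈ˡ xs → f x ≤ g x) → sumℚ f xs ≤ sumℚ g xs
  sum-mono-≤ []       _   = ℚP.≤-refl
  sum-mono-≤ (x ∷ xs) f≤g = ℚP.+-mono-≤ (f≤g x (here refl)) (sum-mono-≤ xs (λ y y∈ → f≤g y (there y∈)))

  sum-mono-< : ∀ xs → (∀ x → x ∈ˡ xs → f x ≤ g x) → ∀ {x₀} → x₀ ∈ˡ xs → f x₀ < g x₀ → sumℚ f xs < sumℚ g xs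
  sum-mono-< (x ∷ xs) f≤g (here refl) fx<gx = ℚP.+-mono-<-≤ fx<gx (sum-mono-≤ xs (λ y y∈ → f≤g y (there y∈)))
  sum-mono-< (x ∷ xs) f≤g (there x₀∈) fx<gx =
    ℚP.+-mono-≤-< (f≤g x (here refl)) (sum-mono-< xs (λ y y∈ → f≤g y (there y∈)) x₀∈ fx<gx)

sum-*ˡ : ∀ c (f : A → ℚ) xs → sumℚ (λ x → c * f x) xs ≡ c * sumℚ f xs
sum-*ˡ c f []       = sym (ℚP.*-zeroʳ c)
sum-*ˡ c f (x ∷ xs) = trans (cong (c * f x +_) (sum-*ˡ c f xs)) (sym (ℚP.*-distribˡ-+ c (f x) (sumℚ f xs)))

sum-nonNeg : {f : A → ℚ} → ∀ xs → (∀ x → x ∈ˡ xs → 0ℚ ≤ f x) → 0ℚ ≤ sumℚ f xs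
sum-nonNeg []       _   = ℚP.≤-refl
sum-nonNeg (x ∷ xs) 0≤f = ℚP.+-mono-≤ (0≤f x (here refl)) (sum-nonNeg xs (λ y y∈ → 0≤f y (there y∈)))

p≤p+q : ∀ {p q} → 0ℚ ≤ q → p ≤ p + q
p≤p+q {p} 0≤q = ℚP.≤-trans (ℚP.≤-reflexive (sym (ℚP.+-identityʳ p))) (ℚP.+-monoʳ-≤ p 0≤q)

p≤q+p : ∀ {p q} → 0ℚ ≤ q → p ≤ q + p
p≤q+p {p} 0≤q = ℚP.≤-trans (ℚP.≤-reflexive (sym (ℚP.+-identityˡ p))) (ℚP.+-monoˡ-≤ p 0≤q)

+-nonNeg-≡0 : ∀ {p q} → 0ℚ ≤ p → 0ℚ ≤ q → p + q ≡ 0ℚ → p ≡ 0ℚ × q ≡ 0ℚ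
+-nonNeg-≡0 0≤p 0≤q p+q≡0 =
  ℚP.≤-antisym (ℚP.≤-trans (p≤p+q 0≤q) (ℚP.≤-reflexive p+q≡0)) 0≤p ,
  ℚP.≤-antisym (ℚP.≤-trans (p≤q+p 0≤p) (ℚP.≤-reflexive p+q≡0)) 0≤q

sum-≡0⁻ : {f : A → ℚ} → ∀ xs → (∀ x → x ∈ˡ xs → 0ℚ ≤ f x) → sumℚ f xs ≡ 0ℚ → ∀ x → x ∈ˡ xs → f x ≡ 0ℚ
sum-≡0⁻ (x ∷ xs) 0≤f sum≡0 .x (here refl) =
  proj₁ (+-nonNeg-≡0 (0≤f x (here refl)) (sum-nonNeg xs (λ y y∈ → 0≤f y (there y∈))) sum≡0)
sum-≡0⁻ (x ∷ xs) 0≤f sum≡0 y (there y∈) =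
  sum-≡0⁻ xs (λ z z∈ → 0≤f z (there z∈))
    (proj₂ (+-nonNeg-≡0 (0≤f x (here refl)) (sum-nonNeg xs (λ z z∈ → 0≤f z (there z∈))) sum≡0)) y y∈

sum-≡0 : {f : A → ℚ} → ∀ xs → (∀ x → x ∈ˡ xs → f x ≡ 0ℚ) → sumℚ f xs ≡ 0ℚ
sum-≡0 []       _    = refl
sum-≡0 (x ∷ xs) f≡0 = cong₂ _+_ (f≡0 x (here refl)) (sum-≡0 xs (λ y y∈ → f≡0 y (there y∈)))

unitCost : ℚ → Bool → Bool → Bool → ℚ
unitCost p true  true  true  = 0ℚ
unitCost p true  true  false = 1ℚ
unitCost p true  false _     = p
unitCost p false true  _     = p
unitCost p false false _     = 0ℚ

unitCost-indicators : ∀ p r₁ r₂ s →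
  indicator (r₁ ∧ r₂ ∧ not s) + p * (indicator (r₁ ∧ not r₂) + indicator (r₂ ∧ not r₁)) ≡ unitCost p r₁ r₂ s
unitCost-indicators p true  true  true  = trans (ℚP.+-identityˡ _) (ℚP.*-zeroʳ p)
unitCost-indicators p true  true  false = trans (cong (1ℚ +_) (ℚP.*-zeroʳ p)) (ℚP.+-identityʳ 1ℚ)
unitCost-indicators p true  false s     = trans (ℚP.+-identityˡ _) (ℚP.*-identityʳ p)
unitCost-indicators p false true  s     = trans (ℚP.+-identityˡ _) (ℚP.*-identityʳ p)
unitCost-indicators p false false s     = trans (ℚP.+-identityˡ _) (ℚP.*-zeroʳ p)

unitCostOf : ℚ → (Subset n → Bool) → (Subset n → Bool) → Subset n → ℚ
unitCostOf p S₁ S₂ X = unitCost p (resolvedIn S₁ X) (resolvedIn S₂ X) (sameTopology S₁ S₂ X)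

dpar≡sum-unitCost : ∀ k p (S₁ S₂ : Subset n → Bool) → dpar k p S₁ S₂ ≡ sumℚ (unitCostOf p S₁ S₂) (kSubsets k n)
dpar≡sum-unitCost {n} k p S₁ S₂ = begin
  ℕtoℚ (#D k S₁ S₂) + p * (ℕtoℚ (#R₁ k S₁ S₂) + ℕtoℚ (#R₂ k S₁ S₂))
    ≡⟨ cong₂ (λ a b → a + p * b) (count≡sum-indicator _ Xs)
             (cong₂ _+_ (count≡sum-indicator _ Xs) (count≡sum-indicator _ Xs)) ⟩
  sumℚ D Xs + p * (sumℚ R₁ Xs + sumℚ R₂ Xs)     ≡⟨ cong (λ a → sumℚ D Xs + p * a) (sum-+ Xs) ⟨
  sumℚ D Xs + p * sumℚ (λ X → R₁ X + R₂ X) Xs   ≡⟨ cong (sumℚ D Xs +_) (sum-*ˡ p _ Xs) ⟨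
  sumℚ D Xs + sumℚ (λ X → p * (R₁ X + R₂ X)) Xs ≡⟨ sum-+ Xs ⟨
  sumℚ (λ X → D X + p * (R₁ X + R₂ X)) Xs        ≡⟨ sum-cong Xs (λ X _ → unitCost-indicators p (r₁ X) (r₂ X) (s X)) ⟩
  sumℚ (unitCostOf p S₁ S₂) Xs                  ∎
  where
  open ≡-Reasoning
  Xs : List (Subset n)
  Xs = kSubsets k n
  r₁ r₂ s : Subset n → Bool
  r₁ = resolvedIn S₁
  r₂ = resolvedIn S₂
  s  = sameTopology S₁ S₂
  D R₁ R₂ : Subset n → ℚ
  D  X = indicator (r₁ X ∧ r₂ X ∧ not (s X))
  R₁ X = indicator (r₁ X ∧ not (r₂ X))
  R₂ X = indicator (r₂ X ∧ not (r₁ X))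

Agree : Bool → Bool → Bool → Set
Agree r₁ r₂ s = r₁ ≡ r₂ × (r₁ ≡ true → s ≡ true)

agree? : ∀ r₁ r₂ s → Agree r₁ r₂ s ⊎ ¬ Agree r₁ r₂ s
agree? true  true  true  = inj₁ (refl , λ _ → refl)
agree? true  true  false = inj₂ λ (_ , s≡true) → case s≡true refl of λ ()
agree? true  false s     = inj₂ λ ()
agree? false true  s     = inj₂ λ ()
agree? false false s     = inj₁ (refl , λ ())

module _ {p : ℚ} where

  unitCost-nonNeg : 0ℚ ≤ p → ∀ r₁ r₂ s → 0ℚ ≤ unitCost p r₁ r₂ s
  unitCost-nonNeg 0≤p true  true  true  = ℚP.≤-refl
  unitCost-nonNeg 0≤p true  true  false = ℚP.nonNegative⁻¹ 1ℚ
  unitCost-nonNeg 0≤p true  false s     = 0≤p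
  unitCost-nonNeg 0≤p false true  s     = 0≤p
  unitCost-nonNeg 0≤p false false s     = ℚP.≤-refl

  unitCost-comm : ∀ r₁ r₂ s → unitCost p r₁ r₂ s ≡ unitCost p r₂ r₁ s
  unitCost-comm true  true  s = refl
  unitCost-comm true  false s = refl
  unitCost-comm false true  s = refl
  unitCost-comm false false s = refl

  unitCost≤1 : p ≤ 1ℚ → ∀ r₁ r₂ s → unitCost p r₁ r₂ s ≤ 1ℚ
  unitCost≤1 p≤1 true  true  true  = ℚP.nonNegative⁻¹ 1ℚ
  unitCost≤1 p≤1 true  true  false = ℚP.≤-refl
  unitCost≤1 p≤1 true  false s     = p≤1
  unitCost≤1 p≤1 false true  s     = p≤1
  unitCost≤1 p≤1 false false s     = ℚP.nonNegative⁻¹ 1ℚ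

  agree⇒unitCost≡0 : ∀ r₁ r₂ s → Agree r₁ r₂ s → unitCost p r₁ r₂ s ≡ 0ℚ
  agree⇒unitCost≡0 true  true  true  _ = refl
  agree⇒unitCost≡0 true  true  false (_ , s≡true) = case s≡true refl of λ ()
  agree⇒unitCost≡0 false false s     _ = refl

  unitCost≡0⇒agree : 0ℚ < p → ∀ r₁ r₂ s → unitCost p r₁ r₂ s ≡ 0ℚ → Agree r₁ r₂ s
  unitCost≡0⇒agree 0<p true  true  true  _   = refl , λ _ → refl
  unitCost≡0⇒agree 0<p true  false s     p≡0 = ⊥-elim (ℚP.<-irrefl (sym p≡0) 0<p)
  unitCost≡0⇒agree 0<p false true  s     p≡0 = ⊥-elim (ℚP.<-irrefl (sym p≡0) 0<p)
  unitCost≡0⇒agree 0<p false false s     _   = refl , λ ()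

  disagree⇒p≤unitCost : p ≤ 1ℚ → ∀ r₁ r₂ s → ¬ Agree r₁ r₂ s → p ≤ unitCost p r₁ r₂ s
  disagree⇒p≤unitCost p≤1 true  true  true  ¬agree = ⊥-elim (¬agree (refl , λ _ → refl))
  disagree⇒p≤unitCost p≤1 true  true  false ¬agree = p≤1
  disagree⇒p≤unitCost p≤1 true  false s     ¬agree = ℚP.≤-refl
  disagree⇒p≤unitCost p≤1 false true  s     ¬agree = ℚP.≤-refl
  disagree⇒p≤unitCost p≤1 false false s     ¬agree = ⊥-elim (¬agree (refl , λ ()))

  unitCost-triangle : ½ ≤ p → ∀ r₁ r₂ r₃ s₁₂ s₂₃ s₁₃ → (s₁₂ ≡ true → s₂₃ ≡ true → s₁₃ ≡ true) →
    unitCost p r₁ r₃ s₁₃ ≤ unitCost p r₁ r₂ s₁₂ + unitCost p r₂ r₃ s₂₃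
  unitCost-triangle ½≤p = by-cases
    where
    0≤p : 0ℚ ≤ p
    0≤p = ℚP.≤-trans (ℚP.nonNegative⁻¹ ½) ½≤p
    cost≥0 : ∀ s → 0ℚ ≤ unitCost p true true s
    cost≥0 = unitCost-nonNeg 0≤p true true
    by-cases : ∀ r₁ r₂ r₃ s₁₂ s₂₃ s₁₃ → (s₁₂ ≡ true → s₂₃ ≡ true → s₁₃ ≡ true) →
      unitCost p r₁ r₃ s₁₃ ≤ unitCost p r₁ r₂ s₁₂ + unitCost p r₂ r₃ s₂₃
    by-cases true  true  true  s₁₂   s₂₃   true  _     = ℚP.+-mono-≤ (cost≥0 s₁₂) (cost≥0 s₂₃)
    by-cases true  true  true  true  true  false chain = case chain refl refl of λ ()
    by-cases true  true  true  false s₂₃   false _     = p≤p+q (cost≥0 s₂₃)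
    by-cases true  true  true  true  false false _     = p≤q+p ℚP.≤-refl
    by-cases true  true  false s₁₂   s₂₃   s₁₃   _     = p≤q+p (cost≥0 s₁₂)
    by-cases true  false true  s₁₂   s₂₃   true  _     = ℚP.+-mono-≤ 0≤p 0≤p
    by-cases true  false true  s₁₂   s₂₃   false _     = ℚP.+-mono-≤ ½≤p ½≤p  -- ½ + ½ computes to 1ℚ
    by-cases true  false false s₁₂   s₂₃   s₁₃   _     = p≤p+q ℚP.≤-refl
    by-cases false true  true  s₁₂   s₂₃   s₁₃   _     = p≤p+q (cost≥0 s₂₃)
    by-cases false true  false s₁₂   s₂₃   s₁₃   _     = ℚP.+-mono-≤ 0≤p 0≤p
    by-cases false false true  s₁₂   s₂₃   s₁₃   _     = p≤q+p ℚP.≤-refl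
    by-cases false false false s₁₂   s₂₃   s₁₃   _     = ℚP.≤-refl

unitCost₀-unresolved : ∀ r s → unitCost 0ℚ r false s ≡ 0ℚ
unitCost₀-unresolved true  s = refl
unitCost₀-unresolved false s = refl

unitCost-via-unresolved : ∀ {p} → p + p ≤ 1ℚ → ∀ r₁ r₂ r₃ s₁₂ s₂₃ s₁₃ → r₂ ≡ false → s₁₃ ≡ false →
  unitCost p r₁ r₂ s₁₂ + unitCost p r₂ r₃ s₂₃ ≤ unitCost p r₁ r₃ s₁₃
unitCost-via-unresolved     p+p≤1 true  false true  _ _ false refl refl = p+p≤1
unitCost-via-unresolved {p} p+p≤1 true  false false _ _ false refl refl = ℚP.≤-reflexive (ℚP.+-identityʳ p)
unitCost-via-unresolved {p} p+p≤1 false false true  _ _ false refl refl = ℚP.≤-reflexive (ℚP.+-identityˡ p)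
unitCost-via-unresolved     p+p≤1 false false false _ _ false refl refl = ℚP.≤-refl

unitCost-via-unresolved-< : ∀ {p} → p + p < 1ℚ → ∀ r₁ r₂ r₃ s₁₂ s₂₃ s₁₃ →
  r₁ ≡ true → r₂ ≡ false → r₃ ≡ true → s₁₃ ≡ false →
  unitCost p r₁ r₂ s₁₂ + unitCost p r₂ r₃ s₂₃ < unitCost p r₁ r₃ s₁₃
unitCost-via-unresolved-< p+p<1 true false true _ _ false refl refl refl refl = p+p<1

cherryIn : (Subset n → Bool) → Subset n → Subset n → Bool
cherryIn S X C = S C ∧ (∣ C ∩ X ∣ ℕ.≡ᵇ 2)

realisedIn : (Subset n → Bool) → Subset n → Subset n → Subset n → Bool
realisedIn S X C C′ = S C′ ∧ ((C′ ∩ X) =ˢ (C ∩ X))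

module _ (S : Subset n → Bool) (X : Subset n) where

  resolved⇒cherry : resolvedIn S X ≡ true → ∃ λ C → S C ≡ true × ∣ C ∩ X ∣ ≡ 2
  resolved⇒cherry e with any-true⇒∃ (cherryIn S X) (allSubsets n) e
  ... | C , _ , e₁ = C , proj₁ (∧-true⁻ e₁) , ≡ᵇ-true⇒≡ (proj₂ (∧-true⁻ e₁))

  cherry⇒resolved : ∀ C → S C ≡ true → ∣ C ∩ X ∣ ≡ 2 → resolvedIn S X ≡ true
  cherry⇒resolved C SC ∣C∩X∣≡2 = ∈⇒any-true (cherryIn S X) (∈-allSubsets C) (cong₂ _∧_ SC (≡⇒≡ᵇ-true ∣C∩X∣≡2))

module _ (S₁ S₂ : Subset n → Bool) (X : Subset n) where

  SameCherry : Set
  SameCherry = ∃ λ C → ∃ λ C′ → S₁ C ≡ true × ∣ C ∩ X ∣ ≡ 2 × S₂ C′ ≡ true × C′ ∩ X ≡ C ∩ X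

  private
    sameCherryAt : Subset n → Bool
    sameCherryAt C = S₁ C ∧ (∣ C ∩ X ∣ ℕ.≡ᵇ 2) ∧ any (realisedIn S₂ X C) (allSubsets n)

  sameTopology⇒cherry : sameTopology S₁ S₂ X ≡ true → SameCherry
  sameTopology⇒cherry e with any-true⇒∃ sameCherryAt (allSubsets n) e
  ... | C , _ , e₁ with ∧-true⁻ e₁
  ... | S₁C , e₂ with ∧-true⁻ e₂
  ... | ∣C∩X∣≡ᵇ2 , e₃ with any-true⇒∃ (realisedIn S₂ X C) (allSubsets n) e₃
  ... | C′ , _ , e₄ with ∧-true⁻ e₄
  ... | S₂C′ , C′∩X=C∩X = C , C′ , S₁C , ≡ᵇ-true⇒≡ ∣C∩X∣≡ᵇ2 , S₂C′ , =ˢ-true⇒≡ C′∩X=C∩X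

  cherry⇒sameTopology : SameCherry → sameTopology S₁ S₂ X ≡ true
  cherry⇒sameTopology (C , C′ , S₁C , ∣C∩X∣≡2 , S₂C′ , C′∩X≡C∩X) =
    ∈⇒any-true sameCherryAt (∈-allSubsets C) (cong₂ _∧_ S₁C (cong₂ _∧_ (≡⇒≡ᵇ-true ∣C∩X∣≡2)
      (∈⇒any-true (realisedIn S₂ X C) (∈-allSubsets C′) (cong₂ _∧_ S₂C′ (≡⇒=ˢ-true C′∩X≡C∩X)))))

sameTopology-comm⇒ : ∀ S₁ S₂ (X : Subset n) → sameTopology S₁ S₂ X ≡ true → sameTopology S₂ S₁ X ≡ true
sameTopology-comm⇒ S₁ S₂ X same with sameTopology⇒cherry S₁ S₂ X same
... | C , C′ , S₁C , ∣C∩X∣≡2 , S₂C′ , C′∩X≡C∩X =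
  cherry⇒sameTopology S₂ S₁ X (C′ , C , S₂C′ , trans (cong ∣_∣ C′∩X≡C∩X) ∣C∩X∣≡2 , S₁C , sym C′∩X≡C∩X)

sameTopology-comm : ∀ S₁ S₂ (X : Subset n) → sameTopology S₁ S₂ X ≡ sameTopology S₂ S₁ X
sameTopology-comm S₁ S₂ X = true⇔true⇒≡ (sameTopology-comm⇒ S₁ S₂ X) (sameTopology-comm⇒ S₂ S₁ X)

-- Holds when X has a unique resolution in S₂ (up to complement, for split systems).
Transfers : (S₂ S₃ : Subset n → Bool) → Subset n → Set
Transfers {n} S₂ S₃ X = ∀ {C D D′ : Subset n} → S₂ C ≡ true → S₂ D ≡ true → ∣ C ∩ X ∣ ≡ 2 → ∣ D ∩ X ∣ ≡ 2 →
  S₃ D′ ≡ true → D′ ∩ X ≡ D ∩ X → ∃ λ F → S₃ F ≡ true × F ∩ X ≡ C ∩ X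

sameTopology-trans : ∀ S₁ S₂ S₃ (X : Subset n) → Transfers S₂ S₃ X →
  sameTopology S₁ S₂ X ≡ true → sameTopology S₂ S₃ X ≡ true → sameTopology S₁ S₃ X ≡ true
sameTopology-trans S₁ S₂ S₃ X transfer same₁₂ same₂₃
  with sameTopology⇒cherry S₁ S₂ X same₁₂ | sameTopology⇒cherry S₂ S₃ X same₂₃
... | C , C′ , S₁C , ∣C∩X∣≡2 , S₂C′ , C′∩X≡C∩X | D , D′ , S₂D , ∣D∩X∣≡2 , S₃D′ , D′∩X≡D∩X
  with transfer S₂C′ S₂D (trans (cong ∣_∣ C′∩X≡C∩X) ∣C∩X∣≡2) ∣D∩X∣≡2 S₃D′ D′∩X≡D∩X
... | F , S₃F , F∩X≡C′∩X = cherry⇒sameTopology S₁ S₃ X (C , F , S₁C , ∣C∩X∣≡2 , S₃F , trans F∩X≡C′∩X C′∩X≡C∩X)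

AgreeOnAll : ℕ → (Subset n → Bool) → (Subset n → Bool) → Set
AgreeOnAll {n} k S₁ S₂ =
  ∀ (X : Subset n) → ∣ X ∣ ≡ k → Agree (resolvedIn S₁ X) (resolvedIn S₂ X) (sameTopology S₁ S₂ X)

AgreeOnAll-sym : ∀ {k} {S₁ S₂ : Subset n → Bool} → AgreeOnAll k S₁ S₂ → AgreeOnAll k S₂ S₁
AgreeOnAll-sym {S₁ = S₁} {S₂} agree X ∣X∣≡k with agree X ∣X∣≡k
... | r₁≡r₂ , same = sym r₁≡r₂ , λ r₂ → sameTopology-comm⇒ S₁ S₂ X (same (trans r₁≡r₂ r₂))

module UnitDistance {T : Set} (S : T → Subset n → Bool) (k : ℕ)
  (sameTopology-trans-unit : ∀ x y z X → ∣ X ∣ ≡ k → sameTopology (S x) (S y) X ≡ true →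
                              sameTopology (S y) (S z) X ≡ true → sameTopology (S x) (S z) X ≡ true)
  (agreeing⇒≡ : ∀ x y → AgreeOnAll k (S x) (S y) → ∀ C → S x C ≡ S y C)
  where

  _≈_ : T → T → Set
  x ≈ y = ∀ C → S x C ≡ S y C

  d : ℚ → T → T → ℚ
  d p x y = dpar k p (S x) (S y)

  Units : List (Subset n)
  Units = kSubsets k n

  cost : ℚ → T → T → Subset n → ℚ
  cost p x y = unitCostOf p (S x) (S y)

  r : T → Subset n → Bool
  r x = resolvedIn (S x)

  s : T → T → Subset n → Bool
  s x y = sameTopology (S x) (S y)

  AgreeOn : T → T → Subset n → Set
  AgreeOn x y X = Agree (r x X) (r y X) (s x y X)

  d≡sum-cost : ∀ p x y → d p x y ≡ sumℚ (cost p x y) Units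
  d≡sum-cost p x y = dpar≡sum-unitCost k p (S x) (S y)

  cost-nonNeg : ∀ {p} → 0ℚ ≤ p → ∀ x y X → 0ℚ ≤ cost p x y X
  cost-nonNeg 0≤p x y X = unitCost-nonNeg 0≤p (r x X) (r y X) (s x y X)

  d-nonNeg : ∀ {p} → 0ℚ ≤ p → ∀ x y → 0ℚ ≤ d p x y
  d-nonNeg {p} 0≤p x y = subst (0ℚ ≤_) (sym (d≡sum-cost p x y)) (sum-nonNeg Units (λ X _ → cost-nonNeg 0≤p x y X))

  d-comm : ∀ p x y → d p x y ≡ d p y x
  d-comm p x y = begin
    d p x y                 ≡⟨ d≡sum-cost p x y ⟩
    sumℚ (cost p x y) Units ≡⟨ sum-cong Units (λ X _ → cost-comm X) ⟩
    sumℚ (cost p y x) Units ≡⟨ d≡sum-cost p y x ⟨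
    d p y x                 ∎
    where
    open ≡-Reasoning
    cost-comm : ∀ X → cost p x y X ≡ cost p y x X
    cost-comm X = trans (unitCost-comm (r x X) (r y X) (s x y X))
                        (cong (unitCost p (r y X) (r x X)) (sameTopology-comm (S x) (S y) X))

  agree-trans : ∀ {x y z X} → ∣ X ∣ ≡ k → AgreeOn x y X → AgreeOn y z X → AgreeOn x z X
  agree-trans {x} {y} {z} {X} ∣X∣≡k (rx≡ry , same-xy) (ry≡rz , same-yz) =
    trans rx≡ry ry≡rz , λ rx → sameTopology-trans-unit x y z X ∣X∣≡k (same-xy rx) (same-yz (trans (sym rx≡ry) rx))

  ≈⇒agree : ∀ {x y} → x ≈ y → ∀ X → AgreeOn x y X
  ≈⇒agree {x} {y} x≈y X = true⇔true⇒≡ (transport x≈y) (transport (λ C → sym (x≈y C))) , same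
    where
    transport : ∀ {x y} → x ≈ y → resolvedIn (S x) X ≡ true → resolvedIn (S y) X ≡ true
    transport {x} {y} x≈y rx with resolved⇒cherry (S x) X rx
    ... | C , SxC , ∣C∩X∣≡2 = cherry⇒resolved (S y) X C (trans (sym (x≈y C)) SxC) ∣C∩X∣≡2
    same : resolvedIn (S x) X ≡ true → sameTopology (S x) (S y) X ≡ true
    same rx with resolved⇒cherry (S x) X rx
    ... | C , SxC , ∣C∩X∣≡2 =
      cherry⇒sameTopology (S x) (S y) X (C , C , SxC , ∣C∩X∣≡2 , trans (sym (x≈y C)) SxC , refl)

  ≈⇒d≡0 : ∀ p {x y} → x ≈ y → d p x y ≡ 0ℚ
  ≈⇒d≡0 p {x} {y} x≈y =
    trans (d≡sum-cost p x y) (sum-≡0 Units (λ X _ → agree⇒unitCost≡0 (r x X) (r y X) (s x y X) (≈⇒agree x≈y X)))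

  d≡0⇒agree : ∀ {p} → 0ℚ < p → ∀ {x y} → d p x y ≡ 0ℚ → ∀ X → ∣ X ∣ ≡ k → AgreeOn x y X
  d≡0⇒agree {p} 0<p {x} {y} d≡0 X ∣X∣≡k = unitCost≡0⇒agree 0<p (r x X) (r y X) (s x y X)
    (sum-≡0⁻ Units (λ X _ → cost-nonNeg (ℚP.<⇒≤ 0<p) x y X) (trans (sym (d≡sum-cost p x y)) d≡0)
             X (∈-kSubsets⁺ X ∣X∣≡k))

  isDistanceMeasure : ∀ {p} → 0ℚ < p → IsDistanceMeasure _≈_ (d p)
  isDistanceMeasure {p} 0<p =
    d-nonNeg (ℚP.<⇒≤ 0<p) , d-comm p ,
    λ x y → mk⇔ (λ d≡0 → agreeing⇒≡ x y (d≡0⇒agree 0<p d≡0)) (≈⇒d≡0 p)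

  triangle : ∀ {p} → ½ ≤ p → ∀ x y z → d p x z ≤ d p x y + d p y z
  triangle {p} ½≤p x y z = begin
    d p x z                                       ≡⟨ d≡sum-cost p x z ⟩
    sumℚ (cost p x z) Units                       ≤⟨ sum-mono-≤ Units unitTriangle ⟩
    sumℚ (λ X → cost p x y X + cost p y z X) Units ≡⟨ sum-+ Units ⟩
    sumℚ (cost p x y) Units + sumℚ (cost p y z) Units ≡⟨ cong₂ _+_ (d≡sum-cost p x y) (d≡sum-cost p y z) ⟨
    d p x y + d p y z                             ∎
    where
    open ℚP.≤-Reasoning
    unitTriangle : ∀ X → X ∈ˡ Units → cost p x z X ≤ cost p x y X + cost p y z X
    unitTriangle X X∈ = unitCost-triangle ½≤p (r x X) (r y X) (r z X) (s x y X) (s y z X) (s x z X)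
                          (sameTopology-trans-unit x y z X (∈-kSubsets⁻ X∈))

  isMetric : ∀ {p} → ½ ≤ p → IsMetric _≈_ (d p)
  isMetric ½≤p = isDistanceMeasure (ℚP.<-≤-trans (ℚP.positive⁻¹ ½) ½≤p) , triangle ½≤p

  pathCost : ℚ → T → List T → T → Subset n → ℚ
  pathCost p x []       z X = cost p x z X
  pathCost p x (y ∷ ys) z X = cost p x y X + pathCost p y ys z X

  pathLength≡sum-pathCost : ∀ p x ys z → pathLength _≈_ (d p) x ys z ≡ sumℚ (pathCost p x ys z) Units
  pathLength≡sum-pathCost p x []       z = d≡sum-cost p x z
  pathLength≡sum-pathCost p x (y ∷ ys) z =
    trans (cong₂ _+_ (d≡sum-cost p x y) (pathLength≡sum-pathCost p y ys z)) (sym (sum-+ Units))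

  pathCost-nonNeg : ∀ {p} → 0ℚ ≤ p → ∀ x ys z X → 0ℚ ≤ pathCost p x ys z X
  pathCost-nonNeg 0≤p x []       z X = cost-nonNeg 0≤p x z X
  pathCost-nonNeg 0≤p x (y ∷ ys) z X = ℚP.+-mono-≤ (cost-nonNeg 0≤p x y X) (pathCost-nonNeg 0≤p y ys z X)

  -- Agreement on X is transitive, so if the ends of the path disagree then some step does.
  agree-or-p≤pathCost : ∀ {p} → 0ℚ ≤ p → p ≤ 1ℚ → ∀ x ys z X → ∣ X ∣ ≡ k → AgreeOn x z X ⊎ p ≤ pathCost p x ys z X
  agree-or-p≤pathCost 0≤p p≤1 x [] z X _ with agree? (r x X) (r z X) (s x z X)
  ... | inj₁ agree    = inj₁ agree
  ... | inj₂ disagree = inj₂ (disagree⇒p≤unitCost p≤1 (r x X) (r z X) (s x z X) disagree)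
  agree-or-p≤pathCost 0≤p p≤1 x (y ∷ ys) z X ∣X∣≡k with agree? (r x X) (r y X) (s x y X)
  ... | inj₂ disagree = inj₂ (ℚP.≤-trans (disagree⇒p≤unitCost p≤1 (r x X) (r y X) (s x y X) disagree)
                                          (p≤p+q (pathCost-nonNeg 0≤p y ys z X)))
  ... | inj₁ agree with agree-or-p≤pathCost 0≤p p≤1 y ys z X ∣X∣≡k
  ...   | inj₁ agree′ = inj₁ (agree-trans ∣X∣≡k agree agree′)
  ...   | inj₂ p≤cost = inj₂ (ℚP.≤-trans p≤cost (p≤q+p (cost-nonNeg 0≤p x y X)))

  near-triangle : ∀ {p c} → 0ℚ ≤ p → p ≤ 1ℚ → 0ℚ ≤ c → c * p ≡ 1ℚ →
                  ∀ x ys z → d p x z ≤ c * pathLength _≈_ (d p) x ys z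
  near-triangle {p} {c} 0≤p p≤1 0≤c c*p≡1 x ys z = begin
    d p x z                                      ≡⟨ d≡sum-cost p x z ⟩
    sumℚ (cost p x z) Units                      ≤⟨ sum-mono-≤ Units unitBound ⟩
    sumℚ (λ X → c * pathCost p x ys z X) Units   ≡⟨ sum-*ˡ c (pathCost p x ys z) Units ⟩
    c * sumℚ (pathCost p x ys z) Units           ≡⟨ cong (c *_) (pathLength≡sum-pathCost p x ys z) ⟨
    c * pathLength _≈_ (d p) x ys z              ∎
    where
    open ℚP.≤-Reasoning
    instance
      _ : NonNegative c
      _ = nonNegative 0≤c
    unitBound : ∀ X → X ∈ˡ Units → cost p x z X ≤ c * pathCost p x ys z X
    unitBound X X∈ with agree-or-p≤pathCost 0≤p p≤1 x ys z X (∈-kSubsets⁻ X∈)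
    ... | inj₁ agree = ℚP.≤-trans (ℚP.≤-reflexive (trans (agree⇒unitCost≡0 (r x X) (r z X) (s x z X) agree)
                                                          (sym (ℚP.*-zeroʳ c))))
                                  (ℚP.*-monoˡ-≤-nonNeg c (pathCost-nonNeg 0≤p x ys z X))
    ... | inj₂ p≤cost = ℚP.≤-trans (unitCost≤1 p≤1 (r x X) (r z X) (s x z X))
                                   (ℚP.≤-trans (ℚP.≤-reflexive (sym c*p≡1)) (ℚP.*-monoˡ-≤-nonNeg c p≤cost))

  isNearMetric : ∀ {p c} → 0ℚ < p → p ≤ 1ℚ → 0ℚ ≤ c → c * p ≡ 1ℚ → NearMetricWith _≈_ (d p) c
  isNearMetric 0<p p≤1 0≤c c*p≡1 =
    isDistanceMeasure 0<p , λ x x₁ xs z → near-triangle (ℚP.<⇒≤ 0<p) p≤1 0≤c c*p≡1 x (x₁ ∷ xs) z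

  Unresolving : T → Set
  Unresolving t = ∀ X → ∣ X ∣ ≡ k → r t X ≡ false

  ¬isDistanceMeasure₀ : ∀ x t → Unresolving t → ¬ (x ≈ t) → ¬ IsDistanceMeasure _≈_ (d 0ℚ)
  ¬isDistanceMeasure₀ x t unresolving x≉t (_ , _ , d≡0⇔≈) = x≉t (Equivalence.to (d≡0⇔≈ x t) d₀≡0)
    where
    d₀≡0 : d 0ℚ x t ≡ 0ℚ
    d₀≡0 = trans (d≡sum-cost 0ℚ x t)
      (sum-≡0 Units (λ X X∈ → subst (λ b → unitCost 0ℚ (r x X) b (s x t X) ≡ 0ℚ)
                                   (sym (unresolving X (∈-kSubsets⁻ X∈)))
                                   (unitCost₀-unresolved (r x X) (s x t X))))

  d-via-unresolving : ∀ {p x t z} → p + p < 1ℚ → Unresolving t → (∀ X → ∣ X ∣ ≡ k → s x z X ≡ false) →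
    ∀ X₀ → ∣ X₀ ∣ ≡ k → r x X₀ ≡ true → r z X₀ ≡ true → d p x t + d p t z < d p x z
  d-via-unresolving {p} {x} {t} {z} p+p<1 unresolving never-same X₀ ∣X₀∣≡k rx rz = begin-strict
    d p x t + d p t z                                  ≡⟨ cong₂ _+_ (d≡sum-cost p x t) (d≡sum-cost p t z) ⟩
    sumℚ (cost p x t) Units + sumℚ (cost p t z) Units  ≡⟨ sum-+ Units ⟨
    sumℚ (λ X → cost p x t X + cost p t z X) Units     <⟨ sum-mono-< Units unitBound X₀∈ unitBound-X₀ ⟩
    sumℚ (cost p x z) Units                            ≡⟨ d≡sum-cost p x z ⟨
    d p x z                                            ∎
    where
    open ℚP.≤-Reasoning
    unitBound : ∀ X → X ∈ˡ Units → cost p x t X + cost p t z X ≤ cost p x z X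
    unitBound X X∈ = unitCost-via-unresolved (ℚP.<⇒≤ p+p<1) (r x X) (r t X) (r z X) (s x t X) (s t z X) (s x z X)
                       (unresolving X (∈-kSubsets⁻ X∈)) (never-same X (∈-kSubsets⁻ X∈))
    X₀∈ : X₀ ∈ˡ Units
    X₀∈ = ∈-kSubsets⁺ X₀ ∣X₀∣≡k
    unitBound-X₀ : cost p x t X₀ + cost p t z X₀ < cost p x z X₀
    unitBound-X₀ = unitCost-via-unresolved-< p+p<1 (r x X₀) (r t X₀) (r z X₀) (s x t X₀) (s t z X₀) (s x z X₀)
                     rx (unresolving X₀ ∣X₀∣≡k) rz (never-same X₀ ∣X₀∣≡k)

  ¬isMetric : ∀ p x t z → p + p < 1ℚ → Unresolving t → (∀ X → ∣ X ∣ ≡ k → s x z X ≡ false) →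
    ∀ X₀ → ∣ X₀ ∣ ≡ k → r x X₀ ≡ true → r z X₀ ≡ true → ¬ IsMetric _≈_ (d p)
  ¬isMetric p x t z p+p<1 unresolving never-same X₀ ∣X₀∣≡k rx rz (_ , triangle′) =
    ℚP.<-irrefl refl (ℚP.<-≤-trans (d-via-unresolving {p} p+p<1 unresolving never-same X₀ ∣X₀∣≡k rx rz)
                                   (triangle′ x t z))

module _ {i : Fin n} {p q : Subset n} where

  ∈-∩⁺ : i ∈ p → i ∈ q → i ∈ p ∩ q
  ∈-∩⁺ i∈p i∈q = SubsetP.x∈p∩q⁺ (i∈p , i∈q)

  ∈-∩⁻ˡ : i ∈ p ∩ q → i ∈ p
  ∈-∩⁻ˡ i∈p∩q = proj₁ (SubsetP.x∈p∩q⁻ p q i∈p∩q)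

  ∈-∩⁻ʳ : i ∈ p ∩ q → i ∈ q
  ∈-∩⁻ʳ i∈p∩q = proj₂ (SubsetP.x∈p∩q⁻ p q i∈p∩q)

  ∈-∪⁺ˡ : i ∈ p → i ∈ p ∪ q
  ∈-∪⁺ˡ i∈p = SubsetP.x∈p∪q⁺ (inj₁ i∈p)

  ∈-∪⁺ʳ : i ∈ q → i ∈ p ∪ q
  ∈-∪⁺ʳ i∈q = SubsetP.x∈p∪q⁺ (inj₂ i∈q)

  ∈-∪⁻ : i ∈ p ∪ q → i ∈ p ⊎ i ∈ q
  ∈-∪⁻ = SubsetP.x∈p∪q⁻ p q

Empty-∩-comm : {C D : Subset n} → Empty (C ∩ D) → Empty (D ∩ C)
Empty-∩-comm {C = C} {D} = subst Empty (SubsetP.∩-comm C D)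

∈-∩-≡ : ∀ {C D X : Subset n} {i} → C ∩ X ≡ D ∩ X → i ∈ X → i ∈ C → i ∈ D
∈-∩-≡ C∩X≡D∩X i∈X i∈C = ∈-∩⁻ˡ (subst (_ ∈_) C∩X≡D∩X (∈-∩⁺ i∈C i∈X))

∩-⊆-stable : ∀ {C D X : Subset n} → (∀ {i} → i ∈ C → i ∈ X → ¬ i ∉ D) → C ∩ X ⊆ D ∩ X
∩-⊆-stable {D = D} ¬¬i∈D {i} i∈C∩X with i SubsetP.∈? D
... | yes i∈D = ∈-∩⁺ i∈D (∈-∩⁻ʳ i∈C∩X)
... | no  i∉D = ⊥-elim (¬¬i∈D (∈-∩⁻ˡ i∈C∩X) (∈-∩⁻ʳ i∈C∩X) i∉D)

∁-involutive : (C : Subset n) → ∁ (∁ C) ≡ C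
∁-involutive C = trans (sym (map-∘ not not C)) (trans (map-cong not-involutive C) (map-id C))

∁-∩-≡ : ∀ {C D X : Subset n} → C ∩ X ≡ D ∩ X → ∁ C ∩ X ≡ ∁ D ∩ X
∁-∩-≡ C∩X≡D∩X = SubsetP.⊆-antisym (one-way C∩X≡D∩X) (one-way (sym C∩X≡D∩X))
  where
  one-way : ∀ {C D X : Subset n} → C ∩ X ≡ D ∩ X → ∁ C ∩ X ⊆ ∁ D ∩ X
  one-way C∩X≡D∩X = ∩-⊆-stable λ i∈∁C i∈X i∉∁D →
    SubsetP.x∈∁p⇒x∉p i∈∁C (∈-∩-≡ (sym C∩X≡D∩X) i∈X (SubsetP.x∉∁p⇒x∈p i∉∁D))

⊆∧∣∣≡⇒≡ : {C D : Subset n} → C ⊆ D → ∣ C ∣ ≡ ∣ D ∣ → C ≡ D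
⊆∧∣∣≡⇒≡ {C = []}        {[]}        _    _ = refl
⊆∧∣∣≡⇒≡ {C = true ∷ C}  {true ∷ D}  C⊆D e = cong (true ∷_) (⊆∧∣∣≡⇒≡ (SubsetP.drop-∷-⊆ C⊆D) (ℕP.suc-injective e))
⊆∧∣∣≡⇒≡ {C = false ∷ C} {false ∷ D} C⊆D e = cong (false ∷_) (⊆∧∣∣≡⇒≡ (SubsetP.drop-∷-⊆ C⊆D) e)
⊆∧∣∣≡⇒≡ {C = true ∷ C}  {false ∷ D} C⊆D e with C⊆D Vec.here
... | ()
⊆∧∣∣≡⇒≡ {C = false ∷ C} {true ∷ D}  C⊆D e =
  ⊥-elim (ℕP.<-irrefl refl (subst (_≤ℕ ∣ D ∣) e (SubsetP.p⊆q⇒∣p∣≤∣q∣ (SubsetP.drop-∷-⊆ C⊆D))))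

∣C∩X∣+∣∁C∩X∣≡∣X∣ : (C X : Subset n) → ∣ C ∩ X ∣ ℕ.+ ∣ ∁ C ∩ X ∣ ≡ ∣ X ∣
∣C∩X∣+∣∁C∩X∣≡∣X∣ []          []          = refl
∣C∩X∣+∣∁C∩X∣≡∣X∣ (true  ∷ C) (true  ∷ X) = cong suc (∣C∩X∣+∣∁C∩X∣≡∣X∣ C X)
∣C∩X∣+∣∁C∩X∣≡∣X∣ (false ∷ C) (true  ∷ X) = trans (ℕP.+-suc _ _) (cong suc (∣C∩X∣+∣∁C∩X∣≡∣X∣ C X))
∣C∩X∣+∣∁C∩X∣≡∣X∣ (true  ∷ C) (false ∷ X) = ∣C∩X∣+∣∁C∩X∣≡∣X∣ C X
∣C∩X∣+∣∁C∩X∣≡∣X∣ (false ∷ C) (false ∷ X) = ∣C∩X∣+∣∁C∩X∣≡∣X∣ C X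

∣∁C∩X∣ : (C X : Subset n) {k m : ℕ} → ∣ X ∣ ≡ k ℕ.+ m → ∣ C ∩ X ∣ ≡ k → ∣ ∁ C ∩ X ∣ ≡ m
∣∁C∩X∣ C X {k} ∣X∣≡k+m ∣C∩X∣≡k =
  ℕP.+-cancelˡ-≡ k _ _ (trans (cong (ℕ._+ ∣ ∁ C ∩ X ∣) (sym ∣C∩X∣≡k)) (trans (∣C∩X∣+∣∁C∩X∣≡∣X∣ C X) ∣X∣≡k+m))

∣⁅i⁆∩X∣≤1 : (i : Fin n) (X : Subset n) → ∣ ⁅ i ⁆ ∩ X ∣ ≤ℕ 1
∣⁅i⁆∩X∣≤1 i X = ℕP.≤-trans (SubsetP.∣p∩q∣≤∣p∣ ⁅ i ⁆ X) (ℕP.≤-reflexive (SubsetP.∣⁅x⁆∣≡1 i))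

∣C∪⁅i⁆∣ : (C : Subset n) (i : Fin n) → i ∉ C → ∣ C ∪ ⁅ i ⁆ ∣ ≡ suc ∣ C ∣
∣C∪⁅i⁆∣ (false ∷ C) Fin.zero    i∉C = cong (suc ∘′ ∣_∣) (SubsetP.∪-identityʳ C)
∣C∪⁅i⁆∣ (true  ∷ C) Fin.zero    i∉C = ⊥-elim (i∉C Vec.here)
∣C∪⁅i⁆∣ (true  ∷ C) (Fin.suc i) i∉C = cong suc (∣C∪⁅i⁆∣ C i (i∉C ∘′ Vec.there))
∣C∪⁅i⁆∣ (false ∷ C) (Fin.suc i) i∉C = ∣C∪⁅i⁆∣ C i (i∉C ∘′ Vec.there)

pair : Fin n → Fin n → Subset n
pair a b = ⁅ a ⁆ ∪ ⁅ b ⁆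

triple : Fin n → Fin n → Fin n → Subset n
triple a b c = pair a b ∪ ⁅ c ⁆

quad : Fin n → Fin n → Fin n → Fin n → Subset n
quad a b c d = pair a b ∪ pair c d

module _ {a b : Fin n} where

  ∈-pairˡ : a ∈ pair a b
  ∈-pairˡ = ∈-∪⁺ˡ (SubsetP.x∈⁅x⁆ a)

  ∈-pairʳ : b ∈ pair a b
  ∈-pairʳ = ∈-∪⁺ʳ (SubsetP.x∈⁅x⁆ b)

  ∈-pair⁻ : ∀ {i} → i ∈ pair a b → i ≡ a ⊎ i ≡ b
  ∈-pair⁻ i∈ with ∈-∪⁻ i∈
  ... | inj₁ i∈⁅a⁆ = inj₁ (SubsetP.x∈⁅y⁆⇒x≡y a i∈⁅a⁆)
  ... | inj₂ i∈⁅b⁆ = inj₂ (SubsetP.x∈⁅y⁆⇒x≡y b i∈⁅b⁆)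

  ∣pair∣≡2 : a ≢ b → ∣ pair a b ∣ ≡ 2
  ∣pair∣≡2 a≢b = trans (∣C∪⁅i⁆∣ ⁅ a ⁆ b (λ b∈⁅a⁆ → a≢b (sym (SubsetP.x∈⁅y⁆⇒x≡y a b∈⁅a⁆))))
                       (cong suc (SubsetP.∣⁅x⁆∣≡1 a))

  ∩≡pair : ∀ {C X} → a ∈ C → b ∈ C → a ∈ X → b ∈ X → (∀ {i} → i ∈ X → i ∈ C → i ≡ a ⊎ i ≡ b) →
           C ∩ X ≡ pair a b
  ∩≡pair a∈C b∈C a∈X b∈X only-a-b = SubsetP.⊆-antisym
    (λ i∈C∩X → [ (λ { refl → ∈-pairˡ }) , (λ { refl → ∈-pairʳ }) ]′ (only-a-b (∈-∩⁻ʳ i∈C∩X) (∈-∩⁻ˡ i∈C∩X)))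
    (λ i∈pair → [ (λ { refl → ∈-∩⁺ a∈C a∈X }) , (λ { refl → ∈-∩⁺ b∈C b∈X }) ]′ (∈-pair⁻ i∈pair))

  pair∩≡pair : ∀ {X} → a ∈ X → b ∈ X → pair a b ∩ X ≡ pair a b
  pair∩≡pair a∈X b∈X = ∩≡pair ∈-pairˡ ∈-pairʳ a∈X b∈X (λ _ i∈pair → ∈-pair⁻ i∈pair)

  ∣pair∩X∣≡2⇒⊆ : ∀ {X} → ∣ pair a b ∩ X ∣ ≡ 2 → a ∈ X × b ∈ X
  ∣pair∩X∣≡2⇒⊆ {X} ∣pair∩X∣≡2 = in-X ∈-pair⁻ , in-X (λ i∈ → swap (∈-pair⁻ i∈))
    where
    in-X : ∀ {x y} → (∀ {i} → i ∈ pair a b → i ≡ x ⊎ i ≡ y) → x ∈ X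
    in-X {x} {y} only-x-y with x SubsetP.∈? X
    ... | yes x∈X = x∈X
    ... | no  x∉X = ⊥-elim (ℕP.<-irrefl refl (begin
      2                  ≡⟨ ∣pair∩X∣≡2 ⟨
      ∣ pair a b ∩ X ∣   ≤⟨ SubsetP.p⊆q⇒∣p∣≤∣q∣ ⊆⁅y⁆ ⟩
      ∣ ⁅ y ⁆ ∣          ≡⟨ SubsetP.∣⁅x⁆∣≡1 y ⟩
      1                  ∎))
      where
      open ℕP.≤-Reasoning
      ⊆⁅y⁆ : pair a b ∩ X ⊆ ⁅ y ⁆
      ⊆⁅y⁆ i∈ with only-x-y (∈-∩⁻ˡ i∈)
      ... | inj₁ refl = ⊥-elim (x∉X (∈-∩⁻ʳ i∈))
      ... | inj₂ refl = SubsetP.x∈⁅x⁆ _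

∣triple∣≡3 : ∀ {a b c : Fin n} → a ≢ b → c ≢ a → c ≢ b → ∣ triple a b c ∣ ≡ 3
∣triple∣≡3 {a = a} {b} {c} a≢b c≢a c≢b =
  trans (∣C∪⁅i⁆∣ (pair a b) c (λ c∈ → [ c≢a , c≢b ]′ (∈-pair⁻ c∈))) (cong suc (∣pair∣≡2 a≢b))

∣quad∣≡4 : ∀ {a b c d : Fin n} → a ≢ b → c ≢ a → c ≢ b → d ≢ a → d ≢ b → d ≢ c → ∣ quad a b c d ∣ ≡ 4
∣quad∣≡4 {a = a} {b} {c} {d} a≢b c≢a c≢b d≢a d≢b d≢c = begin
  ∣ pair a b ∪ (⁅ c ⁆ ∪ ⁅ d ⁆) ∣   ≡⟨ cong ∣_∣ (SubsetP.∪-assoc (pair a b) ⁅ c ⁆ ⁅ d ⁆) ⟨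
  ∣ triple a b c ∪ ⁅ d ⁆ ∣         ≡⟨ ∣C∪⁅i⁆∣ (triple a b c) d d∉ ⟩
  suc ∣ triple a b c ∣             ≡⟨ cong suc (∣triple∣≡3 a≢b c≢a c≢b) ⟩
  4                                ∎
  where
  open ≡-Reasoning
  d∉ : d ∉ triple a b c
  d∉ d∈ with ∈-∪⁻ d∈
  ... | inj₂ d∈⁅c⁆ = d≢c (SubsetP.x∈⁅y⁆⇒x≡y c d∈⁅c⁆)
  ... | inj₁ d∈pair = [ d≢a , d≢b ]′ (∈-pair⁻ d∈pair)

∣⁅i⁆∩X∣≢2 : (i : Fin n) (X : Subset n) → ∣ ⁅ i ⁆ ∩ X ∣ ≢ 2
∣⁅i⁆∩X∣≢2 i X ∣⁅i⁆∩X∣≡2 = ℕP.<-irrefl refl (ℕP.≤-trans (ℕP.≤-reflexive (sym ∣⁅i⁆∩X∣≡2)) (∣⁅i⁆∩X∣≤1 i X))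

pair≢⁅i⁆ : ∀ {a b i : Fin n} → a ≢ b → pair a b ≢ ⁅ i ⁆
pair≢⁅i⁆ {i = i} a≢b pair≡⁅i⁆ = case trans (sym (∣pair∣≡2 a≢b)) (trans (cong ∣_∣ pair≡⁅i⁆) (SubsetP.∣⁅x⁆∣≡1 i)) of λ ()

∣≡2-up-to-∁ : ∀ {A C X : Subset n} → ∣ X ∣ ≡ 4 → C ≡ A ⊎ C ≡ ∁ A → ∣ C ∩ X ∣ ≡ 2 → ∣ A ∩ X ∣ ≡ 2
∣≡2-up-to-∁         ∣X∣≡4 (inj₁ refl) ∣C∩X∣≡2 = ∣C∩X∣≡2
∣≡2-up-to-∁ {A = A} {X = X} ∣X∣≡4 (inj₂ refl) ∣C∩X∣≡2 =
  subst (λ Z → ∣ Z ∩ X ∣ ≡ 2) (∁-involutive A) (∣∁C∩X∣ (∁ A) X ∣X∣≡4 ∣C∩X∣≡2)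

∩-≡-up-to-∁ : ∀ {A B C D X : Subset n} → C ≡ A ⊎ C ≡ ∁ A → D ≡ B ⊎ D ≡ ∁ B → D ∩ X ≡ C ∩ X →
              B ∩ X ≡ A ∩ X ⊎ B ∩ X ≡ ∁ A ∩ X
∩-≡-up-to-∁ (inj₁ refl) (inj₁ refl) B∩X≡A∩X = inj₁ B∩X≡A∩X
∩-≡-up-to-∁ (inj₂ refl) (inj₁ refl) B∩X≡∁A∩X = inj₂ B∩X≡∁A∩X
∩-≡-up-to-∁ {A = A} {B} {X = X} (inj₁ refl) (inj₂ refl) ∁B∩X≡A∩X =
  inj₂ (trans (cong (_∩ X) (sym (∁-involutive B))) (∁-∩-≡ ∁B∩X≡A∩X))
∩-≡-up-to-∁ {A = A} {B} {X = X} (inj₂ refl) (inj₂ refl) ∁B∩X≡∁A∩X =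
  inj₁ (trans (cong (_∩ X) (sym (∁-involutive B))) (trans (∁-∩-≡ ∁B∩X≡∁A∩X) (cong (_∩ X) (∁-involutive A))))

module _ {C Y : Subset n} {a b : Fin n} where

  ∩-cherry : a ∈ C → b ∈ C → (∀ {i} → i ∈ Y → i ∉ C) → C ∩ (pair a b ∪ Y) ≡ pair a b
  ∩-cherry a∈C b∈C Y∩C=∅ = ∩≡pair a∈C b∈C (∈-∪⁺ˡ ∈-pairˡ) (∈-∪⁺ˡ ∈-pairʳ) only-a-b
    where
    only-a-b : ∀ {i} → i ∈ pair a b ∪ Y → i ∈ C → i ≡ a ⊎ i ≡ b
    only-a-b i∈X i∈C with ∈-∪⁻ i∈X
    ... | inj₁ i∈pair = ∈-pair⁻ i∈pair
    ... | inj₂ i∈Y    = ⊥-elim (Y∩C=∅ i∈Y i∈C)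

  ∩-cherry-≡ : ∀ {D} → D ∩ (pair a b ∪ Y) ≡ C ∩ (pair a b ∪ Y) → a ∈ C → b ∈ C → (∀ {i} → i ∈ Y → i ∉ C) →
               a ∈ D × b ∈ D × (∀ {i} → i ∈ Y → i ∉ D)
  ∩-cherry-≡ D∩X≡C∩X a∈C b∈C Y∩C=∅ =
    ∈-∩-≡ (sym D∩X≡C∩X) (∈-∪⁺ˡ ∈-pairˡ) a∈C , ∈-∩-≡ (sym D∩X≡C∩X) (∈-∪⁺ˡ ∈-pairʳ) b∈C ,
    λ i∈Y i∈D → Y∩C=∅ i∈Y (∈-∩-≡ D∩X≡C∩X (∈-∪⁺ʳ i∈Y) i∈D)

-- Uniqueness of the resolution of a unit

cherry-unique : (T : Rooted n) {X C D : Subset n} → ∣ X ∣ ≡ 3 → cl T C ≡ true → cl T D ≡ true →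
                ∣ C ∩ X ∣ ≡ 2 → ∣ D ∩ X ∣ ≡ 2 → C ∩ X ≡ D ∩ X
cherry-unique T {X} {C} {D} ∣X∣≡3 TC TD ∣C∩X∣≡2 ∣D∩X∣≡2 with laminar T C D TC TD
... | inj₁ C⊆D =
  ⊆∧∣∣≡⇒≡ (∩-⊆-stable λ i∈C _ i∉D → i∉D (C⊆D i∈C)) (trans ∣C∩X∣≡2 (sym ∣D∩X∣≡2))
... | inj₂ (inj₁ D⊆C) =
  sym (⊆∧∣∣≡⇒≡ (∩-⊆-stable λ i∈D _ i∉C → i∉C (D⊆C i∈D)) (trans ∣D∩X∣≡2 (sym ∣C∩X∣≡2)))
... | inj₂ (inj₂ C∩D=∅) = ⊥-elim (ℕP.<-irrefl refl (begin
  2               ≡⟨ ∣D∩X∣≡2 ⟨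
  ∣ D ∩ X ∣       ≤⟨ SubsetP.p⊆q⇒∣p∣≤∣q∣ (∩-⊆-stable λ {i} i∈D _ i∉∁C → C∩D=∅ (i , ∈-∩⁺ (SubsetP.x∉∁p⇒x∈p i∉∁C) i∈D)) ⟩
  ∣ ∁ C ∩ X ∣     ≡⟨ ∣∁C∩X∣ C X ∣X∣≡3 ∣C∩X∣≡2 ⟩
  1               ∎))
  where open ℕP.≤-Reasoning

split-unique : (T : Unrooted n) {X C D : Subset n} → ∣ X ∣ ≡ 4 → sp T C ≡ true → sp T D ≡ true →
               ∣ C ∩ X ∣ ≡ 2 → ∣ D ∩ X ∣ ≡ 2 → C ∩ X ≡ D ∩ X ⊎ C ∩ X ≡ ∁ D ∩ X
split-unique T {X} {C} {D} ∣X∣≡4 TC TD ∣C∩X∣≡2 ∣D∩X∣≡2 with compat T C D TC TD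
... | inj₁ C∩D=∅ = inj₂ (⊆∧∣∣≡⇒≡
  (∩-⊆-stable λ {i} i∈C _ i∉∁D → C∩D=∅ (i , ∈-∩⁺ i∈C (SubsetP.x∉∁p⇒x∈p i∉∁D)))
  (trans ∣C∩X∣≡2 (sym (∣∁C∩X∣ D X ∣X∣≡4 ∣D∩X∣≡2))))
... | inj₂ (inj₁ C∩∁D=∅) = inj₁ (⊆∧∣∣≡⇒≡
  (∩-⊆-stable λ {i} i∈C _ i∉D → C∩∁D=∅ (i , ∈-∩⁺ i∈C (SubsetP.x∉p⇒x∈∁p i∉D)))
  (trans ∣C∩X∣≡2 (sym ∣D∩X∣≡2)))
... | inj₂ (inj₂ (inj₁ ∁C∩D=∅)) = inj₁ (sym (⊆∧∣∣≡⇒≡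
  (∩-⊆-stable λ {i} i∈D _ i∉C → ∁C∩D=∅ (i , ∈-∩⁺ (SubsetP.x∉p⇒x∈∁p i∉C) i∈D))
  (trans ∣D∩X∣≡2 (sym ∣C∩X∣≡2))))
... | inj₂ (inj₂ (inj₂ ∁C∩∁D=∅)) = inj₂ (sym (⊆∧∣∣≡⇒≡
  (∩-⊆-stable λ {i} i∈∁D _ i∉C → ∁C∩∁D=∅ (i , ∈-∩⁺ (SubsetP.x∉p⇒x∈∁p i∉C) i∈∁D))
  (trans (∣∁C∩X∣ D X ∣X∣≡4 ∣D∩X∣≡2) (sym ∣C∩X∣≡2))))

sameTopology-trans-rooted : ∀ (T₁ T₂ T₃ : Rooted n) X → ∣ X ∣ ≡ 3 →
  sameTopology (cl T₁) (cl T₂) X ≡ true → sameTopology (cl T₂) (cl T₃) X ≡ true →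
  sameTopology (cl T₁) (cl T₃) X ≡ true
sameTopology-trans-rooted T₁ T₂ T₃ X ∣X∣≡3 = sameTopology-trans (cl T₁) (cl T₂) (cl T₃) X
  λ T₂C T₂D ∣C∩X∣≡2 ∣D∩X∣≡2 T₃D′ D′∩X≡D∩X →
    _ , T₃D′ , trans D′∩X≡D∩X (sym (cherry-unique T₂ ∣X∣≡3 T₂C T₂D ∣C∩X∣≡2 ∣D∩X∣≡2))

sameTopology-trans-unrooted : ∀ (T₁ T₂ T₃ : Unrooted n) X → ∣ X ∣ ≡ 4 →
  sameTopology (sp T₁) (sp T₂) X ≡ true → sameTopology (sp T₂) (sp T₃) X ≡ true →
  sameTopology (sp T₁) (sp T₃) X ≡ true
sameTopology-trans-unrooted T₁ T₂ T₃ X ∣X∣≡4 = sameTopology-trans (sp T₁) (sp T₂) (sp T₃) X transfer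
  where
  transfer : Transfers (sp T₂) (sp T₃) X
  transfer {D′ = D′} T₂C T₂D ∣C∩X∣≡2 ∣D∩X∣≡2 T₃D′ D′∩X≡D∩X with split-unique T₂ ∣X∣≡4 T₂C T₂D ∣C∩X∣≡2 ∣D∩X∣≡2
  ... | inj₁ C∩X≡D∩X  = D′ , T₃D′ , trans D′∩X≡D∩X (sym C∩X≡D∩X)
  ... | inj₂ C∩X≡∁D∩X = ∁ D′ , trans (sym (symm T₃ D′)) T₃D′ , trans (∁-∩-≡ D′∩X≡D∩X) (sym C∩X≡∁D∩X)

-- Reconstruction of a tree from its resolved units

nonempty-of-≢⊥ : {C : Subset n} → C ≢ ⊥ → Nonempty C
nonempty-of-≢⊥ {C = C} C≢⊥ with SubsetP.nonempty? C
... | yes nonempty = nonempty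
... | no  empty    = ⊥-elim (C≢⊥ (SubsetP.Empty-unique empty))

-- The good sets containing a form a chain.  For each b ∈ C some good set contains a and b
-- but nothing outside C, and the largest of these finitely many sets is C itself.
module Assembly (good : Subset n → Set) (a : Fin n) (C : Subset n) (a∈C : a ∈ C)
  (nested    : ∀ {D F} → good D → good F → a ∈ D → a ∈ F → D ⊆ F ⊎ F ⊆ D)
  (good-⁅a⁆  : good ⁅ a ⁆)
  (covers    : ∀ {b} → b ∈ C → ∃ λ D → good D × a ∈ D × b ∈ D)
  (separates : ∀ {b x} → b ∈ C → x ∉ C → ∃ λ D → good D × a ∈ D × b ∈ D × x ∉ D)
  where

  avoiding : ∀ {b} → b ∈ C → (xs : List (Fin n)) →
             ∃ λ G → good G × a ∈ G × b ∈ G × (∀ x → x ∈ˡ xs → x ∉ C → x ∉ G)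
  avoiding b∈C [] with covers b∈C
  ... | D , good-D , a∈D , b∈D = D , good-D , a∈D , b∈D , λ _ ()
  avoiding b∈C (x ∷ xs) with avoiding b∈C xs | x SubsetP.∈? C
  ... | G , good-G , a∈G , b∈G , avoids | yes x∈C =
    G , good-G , a∈G , b∈G , λ { _ (here refl) x∉C → ⊥-elim (x∉C x∈C) ; y (there y∈) → avoids y y∈ }
  ... | G , good-G , a∈G , b∈G , avoids | no x∉C with separates b∈C x∉C
  ...   | D , good-D , a∈D , b∈D , x∉D with nested good-G good-D a∈G a∈D
  ...     | inj₁ G⊆D = G , good-G , a∈G , b∈G ,
              λ { _ (here refl) _ x∈G → x∉D (G⊆D x∈G) ; y (there y∈) → avoids y y∈ }
  ...     | inj₂ D⊆G = D , good-D , a∈D , b∈D ,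
              λ { _ (here refl) _ → x∉D ; y (there y∈) y∉C y∈D → avoids y y∈ y∉C (D⊆G y∈D) }

  inside : ∀ {b} → b ∈ C → ∃ λ G → good G × a ∈ G × b ∈ G × G ⊆ C
  inside b∈C with avoiding b∈C (allFin n)
  ... | G , good-G , a∈G , b∈G , avoids = G , good-G , a∈G , b∈G , G⊆C
    where
    G⊆C : G ⊆ C
    G⊆C {y} y∈G with y SubsetP.∈? C
    ... | yes y∈C = y∈C
    ... | no  y∉C = ⊥-elim (avoids y (∈-allFin y) y∉C y∈G)

  covering : (bs : List (Fin n)) → ∃ λ U → good U × a ∈ U × U ⊆ C × (∀ b → b ∈ˡ bs → b ∈ C → b ∈ U)
  covering [] = ⁅ a ⁆ , good-⁅a⁆ , SubsetP.x∈⁅x⁆ a ,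
                (λ y∈⁅a⁆ → subst (_∈ C) (sym (SubsetP.x∈⁅y⁆⇒x≡y a y∈⁅a⁆)) a∈C) , λ _ ()
  covering (b ∷ bs) with covering bs | b SubsetP.∈? C
  ... | U , good-U , a∈U , U⊆C , covered | no b∉C =
    U , good-U , a∈U , U⊆C , λ { _ (here refl) b∈C → ⊥-elim (b∉C b∈C) ; y (there y∈) → covered y y∈ }
  ... | U , good-U , a∈U , U⊆C , covered | yes b∈C with inside b∈C
  ...   | G , good-G , a∈G , b∈G , G⊆C with nested good-U good-G a∈U a∈G
  ...     | inj₁ U⊆G = G , good-G , a∈G , G⊆C , λ { _ (here refl) _ → b∈G ; y (there y∈) y∈C → U⊆G (covered y y∈ y∈C) }
  ...     | inj₂ G⊆U = U , good-U , a∈U , U⊆C , λ { _ (here refl) _ → G⊆U b∈G ; y (there y∈) → covered y y∈ }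

  assembled : good C
  assembled with covering (allFin n)
  ... | U , good-U , _ , U⊆C , covered =
    subst good (SubsetP.⊆-antisym U⊆C (λ {y} y∈C → covered y (∈-allFin y) y∈C)) good-U

realised-in : ∀ {k} {S₁ S₂ : Subset n → Bool} → AgreeOnAll k S₁ S₂ →
  ∀ {X C} → ∣ X ∣ ≡ k → S₁ C ≡ true → ∣ C ∩ X ∣ ≡ 2 → SameCherry S₁ S₂ X
realised-in {S₁ = S₁} {S₂} agree {X} {C} ∣X∣≡k S₁C ∣C∩X∣≡2 =
  sameTopology⇒cherry S₁ S₂ X (proj₂ (agree X ∣X∣≡k) (cherry⇒resolved S₁ X C S₁C ∣C∩X∣≡2))

x∉C⇒≢ : ∀ {C : Subset n} {x y} → x ∉ C → y ∈ C → x ≢ y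
x∉C⇒≢ x∉C y∈C refl = x∉C y∈C

triplet-separation : (T₁ T₂ : Rooted n) → AgreeOnAll 3 (cl T₁) (cl T₂) →
  ∀ {C a b x} → cl T₁ C ≡ true → a ∈ C → b ∈ C → x ∉ C → a ≢ b →
  ∃ λ D → cl T₂ D ≡ true × a ∈ D × b ∈ D × x ∉ D
triplet-separation {n} T₁ T₂ agree {C} {a} {b} {x} T₁C a∈C b∈C x∉C a≢b =
  separate (realised-in agree ∣X∣≡3 T₁C ∣C∩X∣≡2)
  where
  X : Subset n
  X = triple a b x
  ∣X∣≡3 : ∣ X ∣ ≡ 3
  ∣X∣≡3 = ∣triple∣≡3 a≢b (x∉C⇒≢ x∉C a∈C) (x∉C⇒≢ x∉C b∈C)
  x-outside : ∀ {i} → i ∈ ⁅ x ⁆ → i ∉ C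
  x-outside i∈⁅x⁆ = subst (_∉ C) (sym (SubsetP.x∈⁅y⁆⇒x≡y x i∈⁅x⁆)) x∉C
  ∣C∩X∣≡2 : ∣ C ∩ X ∣ ≡ 2
  ∣C∩X∣≡2 = trans (cong ∣_∣ (∩-cherry a∈C b∈C x-outside)) (∣pair∣≡2 a≢b)
  separate : SameCherry (cl T₁) (cl T₂) X → ∃ λ D → cl T₂ D ≡ true × a ∈ D × b ∈ D × x ∉ D
  separate (C₁ , C₂ , T₁C₁ , ∣C₁∩X∣≡2 , T₂C₂ , C₂∩X≡C₁∩X)
    with ∩-cherry-≡ (trans C₂∩X≡C₁∩X (cherry-unique T₁ ∣X∣≡3 T₁C₁ T₁C ∣C₁∩X∣≡2 ∣C∩X∣≡2)) a∈C b∈C x-outside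
  ... | a∈C₂ , b∈C₂ , x-outside-C₂ = C₂ , T₂C₂ , a∈C₂ , b∈C₂ , x-outside-C₂ (SubsetP.x∈⁅x⁆ x)

quartet-separation : (T₁ T₂ : Unrooted n) → AgreeOnAll 4 (sp T₁) (sp T₂) →
  ∀ {A a b c d} → sp T₁ A ≡ true → a ∈ A → b ∈ A → c ∉ A → d ∉ A → a ≢ b → c ≢ d →
  ∃ λ D → sp T₂ D ≡ true × a ∈ D × b ∈ D × c ∉ D × d ∉ D
quartet-separation {n} T₁ T₂ agree {A} {a} {b} {c} {d} T₁A a∈A b∈A c∉A d∉A a≢b c≢d =
  separate (realised-in agree ∣X∣≡4 T₁A ∣A∩X∣≡2)
  where
  X : Subset n
  X = quad a b c d
  ∣X∣≡4 : ∣ X ∣ ≡ 4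
  ∣X∣≡4 = ∣quad∣≡4 a≢b (x∉C⇒≢ c∉A a∈A) (x∉C⇒≢ c∉A b∈A) (x∉C⇒≢ d∉A a∈A) (x∉C⇒≢ d∉A b∈A) (≢-sym c≢d)
  cd-outside : ∀ {i} → i ∈ pair c d → i ∉ A
  cd-outside i∈cd with ∈-pair⁻ i∈cd
  ... | inj₁ refl = c∉A
  ... | inj₂ refl = d∉A
  ∣A∩X∣≡2 : ∣ A ∩ X ∣ ≡ 2
  ∣A∩X∣≡2 = trans (cong ∣_∣ (∩-cherry a∈A b∈A cd-outside)) (∣pair∣≡2 a≢b)
  separating : ∀ {D} → sp T₂ D ≡ true → D ∩ X ≡ A ∩ X → ∃ λ D → sp T₂ D ≡ true × a ∈ D × b ∈ D × c ∉ D × d ∉ D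
  separating {D} T₂D D∩X≡A∩X with ∩-cherry-≡ D∩X≡A∩X a∈A b∈A cd-outside
  ... | a∈D , b∈D , cd-outside-D = D , T₂D , a∈D , b∈D , cd-outside-D ∈-pairˡ , cd-outside-D ∈-pairʳ
  separate : SameCherry (sp T₁) (sp T₂) X → ∃ λ D → sp T₂ D ≡ true × a ∈ D × b ∈ D × c ∉ D × d ∉ D
  separate (A₁ , A₂ , T₁A₁ , ∣A₁∩X∣≡2 , T₂A₂ , A₂∩X≡A₁∩X) with split-unique T₁ ∣X∣≡4 T₁A₁ T₁A ∣A₁∩X∣≡2 ∣A∩X∣≡2
  ... | inj₁ A₁∩X≡A∩X  = separating T₂A₂ (trans A₂∩X≡A₁∩X A₁∩X≡A∩X)
  ... | inj₂ A₁∩X≡∁A∩X = separating (trans (sym (symm T₂ A₂)) T₂A₂)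
    (trans (∁-∩-≡ (trans A₂∩X≡A₁∩X A₁∩X≡∁A∩X)) (cong (_∩ X) (∁-involutive A)))

clusters-from-triplets : (T₁ T₂ : Rooted n) → AgreeOnAll 3 (cl T₁) (cl T₂) → ∀ C → cl T₁ C ≡ true → cl T₂ C ≡ true
clusters-from-triplets {n} T₁ T₂ agree C T₁C = Assembly.assembled good a C a∈C nested (single T₂ a) covers separates
  where
  good : Subset n → Set
  good D = cl T₂ D ≡ true
  C≢⊥ : C ≢ ⊥
  C≢⊥ refl = case trans (sym T₁C) (nonempt T₁) of λ ()
  a : Fin n
  a = proj₁ (nonempty-of-≢⊥ C≢⊥)
  a∈C : a ∈ C
  a∈C = proj₂ (nonempty-of-≢⊥ C≢⊥)
  nested : ∀ {D F} → good D → good F → a ∈ D → a ∈ F → D ⊆ F ⊎ F ⊆ D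
  nested {D} {F} T₂D T₂F a∈D a∈F with laminar T₂ D F T₂D T₂F
  ... | inj₁ D⊆F          = inj₁ D⊆F
  ... | inj₂ (inj₁ F⊆D)   = inj₂ F⊆D
  ... | inj₂ (inj₂ D∩F=∅) = ⊥-elim (D∩F=∅ (a , ∈-∩⁺ a∈D a∈F))
  covers : ∀ {b} → b ∈ C → ∃ λ D → good D × a ∈ D × b ∈ D
  covers _ = ⊤ , full T₂ , SubsetP.∈⊤ , SubsetP.∈⊤
  separates : ∀ {b x} → b ∈ C → x ∉ C → ∃ λ D → good D × a ∈ D × b ∈ D × x ∉ D
  separates {b} {x} b∈C x∉C with b FinP.≟ a
  ... | yes refl = ⁅ a ⁆ , single T₂ a , SubsetP.x∈⁅x⁆ a , SubsetP.x∈⁅x⁆ a ,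
                   λ x∈⁅a⁆ → x∉C (subst (_∈ C) (sym (SubsetP.x∈⁅y⁆⇒x≡y a x∈⁅a⁆)) a∈C)
  ... | no b≢a   = triplet-separation T₁ T₂ agree T₁C a∈C b∈C x∉C (≢-sym b≢a)

rooted-from-triplets : (T₁ T₂ : Rooted n) → AgreeOnAll 3 (cl T₁) (cl T₂) → T₁ ≈R T₂
rooted-from-triplets T₁ T₂ agree C =
  true⇔true⇒≡ (clusters-from-triplets T₁ T₂ agree C) (clusters-from-triplets T₂ T₁ (AgreeOnAll-sym agree) C)

-- Fixing a leaf c ∉ A, the splits of T₂ are represented by their sides avoiding c,
-- and those containing a given leaf form a chain.
splits-from-quartets′ : (T₁ T₂ : Unrooted n) → AgreeOnAll 4 (sp T₁) (sp T₂) → ∀ {A c d} → sp T₁ A ≡ true →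
  c ∉ A → d ∉ A → d ≢ c → Nonempty A → sp T₂ A ≡ true
splits-from-quartets′ {n} T₁ T₂ agree {A} {c} {d} T₁A c∉A d∉A d≢c (a , a∈A) =
  proj₁ (Assembly.assembled good a A a∈A nested (trivial T₂ a , a-side c∉A) covers separates)
  where
  good : Subset n → Set
  good D = sp T₂ D ≡ true × c ∉ D
  a-side : ∀ {x} → x ∉ A → x ∉ ⁅ a ⁆
  a-side x∉A x∈⁅a⁆ = x∉A (subst (_∈ A) (sym (SubsetP.x∈⁅y⁆⇒x≡y a x∈⁅a⁆)) a∈A)
  nested : ∀ {D F} → good D → good F → a ∈ D → a ∈ F → D ⊆ F ⊎ F ⊆ D
  nested {D} {F} (T₂D , c∉D) (T₂F , c∉F) a∈D a∈F with compat T₂ D F T₂D T₂F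
  ... | inj₁ D∩F=∅ = ⊥-elim (D∩F=∅ (a , ∈-∩⁺ a∈D a∈F))
  ... | inj₂ (inj₁ D∩∁F=∅) = inj₁ λ {i} i∈D →
    SubsetP.x∉∁p⇒x∈p λ i∈∁F → D∩∁F=∅ (i , ∈-∩⁺ i∈D i∈∁F)
  ... | inj₂ (inj₂ (inj₁ ∁D∩F=∅)) = inj₂ λ {i} i∈F →
    SubsetP.x∉∁p⇒x∈p λ i∈∁D → ∁D∩F=∅ (i , ∈-∩⁺ i∈∁D i∈F)
  ... | inj₂ (inj₂ (inj₂ ∁D∩∁F=∅)) =
    ⊥-elim (∁D∩∁F=∅ (c , ∈-∩⁺ (SubsetP.x∉p⇒x∈∁p c∉D) (SubsetP.x∉p⇒x∈∁p c∉F)))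
  separates : ∀ {b x} → b ∈ A → x ∉ A → ∃ λ D → good D × a ∈ D × b ∈ D × x ∉ D
  separates {b} {x} b∈A x∉A with b FinP.≟ a | x FinP.≟ c
  ... | yes refl | _ = ⁅ a ⁆ , (trivial T₂ a , a-side c∉A) , SubsetP.x∈⁅x⁆ a , SubsetP.x∈⁅x⁆ a , a-side x∉A
  ... | no b≢a | yes refl with quartet-separation T₁ T₂ agree T₁A a∈A b∈A c∉A d∉A (≢-sym b≢a) (≢-sym d≢c)
  ...   | D , T₂D , a∈D , b∈D , c∉D , _ = D , (T₂D , c∉D) , a∈D , b∈D , c∉D
  separates {b} {x} b∈A x∉A | no b≢a | no x≢c
    with quartet-separation T₁ T₂ agree T₁A a∈A b∈A c∉A x∉A (≢-sym b≢a) (≢-sym x≢c)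
  ...   | D , T₂D , a∈D , b∈D , c∉D , x∉D = D , (T₂D , c∉D) , a∈D , b∈D , x∉D
  covers : ∀ {b} → b ∈ A → ∃ λ D → good D × a ∈ D × b ∈ D
  covers b∈A with separates b∈A c∉A
  ... | D , good-D , a∈D , b∈D , _ = D , good-D , a∈D , b∈D

splits-from-quartets : (T₁ T₂ : Unrooted n) → AgreeOnAll 4 (sp T₁) (sp T₂) → ∀ A → sp T₁ A ≡ true → sp T₂ A ≡ true
splits-from-quartets {n} T₁ T₂ agree A T₁A = by-second-leaf (FinP.any? λ i → ¬? (i SubsetP.∈? A) ×-dec ¬? (i FinP.≟ c))
  where
  nonempty : ∀ {B} → sp T₁ B ≡ true → Nonempty B
  nonempty {B} T₁B = nonempty-of-≢⊥ λ { refl → case trans (sym T₁B) (nonempt T₁) of λ () }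
  c : Fin n
  c = proj₁ (nonempty (trans (sym (symm T₁ A)) T₁A))
  c∉A : c ∉ A
  c∉A = SubsetP.x∈∁p⇒x∉p (proj₂ (nonempty (trans (sym (symm T₁ A)) T₁A)))
  by-second-leaf : Dec (∃ λ d → d ∉ A × d ≢ c) → sp T₂ A ≡ true
  by-second-leaf (yes (d , d∉A , d≢c)) = splits-from-quartets′ T₁ T₂ agree T₁A c∉A d∉A d≢c (nonempty T₁A)
  by-second-leaf (no no-second) = trans (symm T₂ A) (subst (λ B → sp T₂ B ≡ true) (sym ∁A≡⁅c⁆) (trivial T₂ c))
    where
    ∁A≡⁅c⁆ : ∁ A ≡ ⁅ c ⁆
    ∁A≡⁅c⁆ = SubsetP.⊆-antisym
      (λ {i} i∈∁A → case i FinP.≟ c of λ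
        { (yes refl) → SubsetP.x∈⁅x⁆ c
        ; (no i≢c) → ⊥-elim (no-second (i , SubsetP.x∈∁p⇒x∉p i∈∁A , i≢c)) })
      (λ {i} i∈⁅c⁆ → subst (_∈ ∁ A) (sym (SubsetP.x∈⁅y⁆⇒x≡y c i∈⁅c⁆)) (SubsetP.x∉p⇒x∈∁p c∉A))

unrooted-from-quartets : (T₁ T₂ : Unrooted n) → AgreeOnAll 4 (sp T₁) (sp T₂) → T₁ ≈U T₂
unrooted-from-quartets T₁ T₂ agree A =
  true⇔true⇒≡ (splits-from-quartets T₁ T₂ agree A) (splits-from-quartets T₂ T₁ (AgreeOnAll-sym agree) A)

-- Trees with a single nontrivial cluster or split

listed : List (Subset n) → Subset n → Bool
listed Cs C = any (C =ˢ_) Cs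

listed⁻ : ∀ {Cs} {C : Subset n} → listed Cs C ≡ true → C ∈ˡ Cs
listed⁻ {Cs = Cs} {C} e with any-true⇒∃ (C =ˢ_) Cs e
... | D , D∈Cs , C=D = subst (_∈ˡ Cs) (sym (=ˢ-true⇒≡ C=D)) D∈Cs

listed⁺ : ∀ {Cs} {C : Subset n} → C ∈ˡ Cs → listed Cs C ≡ true
listed⁺ {C = C} C∈Cs = ∈⇒any-true (C =ˢ_) C∈Cs (≡⇒=ˢ-true refl)

unlisted : ∀ {Cs} {C : Subset n} → ¬ C ∈ˡ Cs → listed Cs C ≡ false
unlisted C∉Cs = ¬-not (λ listed≡true → C∉Cs (listed⁻ listed≡true))

singletons : (n : ℕ) → List (Subset n)
singletons n = map ⁅_⁆ (allFin n)

∈-singletons⁻ : {C : Subset n} → C ∈ˡ singletons n → ∃ λ i → C ≡ ⁅ i ⁆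
∈-singletons⁻ C∈ with ∈-map⁻ ⁅_⁆ C∈
... | i , _ , C≡⁅i⁆ = i , C≡⁅i⁆

⁅i⁆∈singletons : (i : Fin n) → ⁅ i ⁆ ∈ˡ singletons n
⁅i⁆∈singletons i = ∈-map⁺ ⁅_⁆ (∈-allFin i)

Laminar : Subset n → Subset n → Set
Laminar A B = A ⊆ B ⊎ B ⊆ A ⊎ Empty (A ∩ B)

laminar-comm : {A B : Subset n} → Laminar A B → Laminar B A
laminar-comm (inj₁ A⊆B)          = inj₂ (inj₁ A⊆B)
laminar-comm (inj₂ (inj₁ B⊆A))   = inj₁ B⊆A
laminar-comm (inj₂ (inj₂ A∩B=∅)) = inj₂ (inj₂ (Empty-∩-comm A∩B=∅))

laminar-⁅i⁆ : (i : Fin n) (B : Subset n) → Laminar ⁅ i ⁆ B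
laminar-⁅i⁆ i B with i SubsetP.∈? B
... | yes i∈B = inj₁ λ j∈⁅i⁆ → subst (_∈ B) (sym (SubsetP.x∈⁅y⁆⇒x≡y i j∈⁅i⁆)) i∈B
... | no  i∉B = inj₂ (inj₂ λ (j , j∈⁅i⁆∩B) →
  i∉B (subst (_∈ B) (SubsetP.x∈⁅y⁆⇒x≡y i (∈-∩⁻ˡ j∈⁅i⁆∩B)) (∈-∩⁻ʳ j∈⁅i⁆∩B)))

Basic : Subset n → Subset n → Set
Basic K C = C ≡ K ⊎ ∃ λ i → C ≡ ⁅ i ⁆

basic-laminar : ∀ {K A B : Subset n} → Basic K A → Basic K B → Laminar A B
basic-laminar (inj₂ (i , refl)) _                 = laminar-⁅i⁆ i _
basic-laminar (inj₁ refl)       (inj₂ (j , refl)) = laminar-comm (laminar-⁅i⁆ j _)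
basic-laminar (inj₁ refl)       (inj₁ refl)       = inj₁ λ i∈ → i∈

module OneCluster (K : Subset n) (k₀ : Fin n) (k₀∈K : k₀ ∈ K) where

  clusters : List (Subset n)
  clusters = ⊤ ∷ K ∷ singletons n

  ∈-clusters⁻ : ∀ {C} → C ∈ˡ clusters → C ≡ ⊤ ⊎ Basic K C
  ∈-clusters⁻ (here C≡⊤)                 = inj₁ C≡⊤
  ∈-clusters⁻ (there (here C≡K))         = inj₂ (inj₁ C≡K)
  ∈-clusters⁻ (there (there C∈singletons)) = inj₂ (inj₂ (∈-singletons⁻ C∈singletons))

  tree : Rooted n
  tree = record
    { cl      = listed clusters
    ; full    = listed⁺ {Cs = clusters} {⊤} (here refl)
    ; single  = λ i → listed⁺ {Cs = clusters} {⁅ i ⁆} (there (there (⁅i⁆∈singletons i)))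
    ; nonempt = unlisted {Cs = clusters} {⊥} λ ⊥∈ → [ (λ ⊥≡⊤ → SubsetP.∉⊥ (subst (k₀ ∈_) (sym ⊥≡⊤) SubsetP.∈⊤)) ,
                                  [ (λ ⊥≡K → SubsetP.∉⊥ (subst (k₀ ∈_) (sym ⊥≡K) k₀∈K)) ,
                                    (λ (i , ⊥≡⁅i⁆) → SubsetP.∉⊥ (subst (i ∈_) (sym ⊥≡⁅i⁆) (SubsetP.x∈⁅x⁆ i))) ]′ ]′
                                (∈-clusters⁻ ⊥∈)
    ; laminar = λ A B A∈ B∈ →
        pairwise-laminar (∈-clusters⁻ (listed⁻ {Cs = clusters} A∈)) (∈-clusters⁻ (listed⁻ {Cs = clusters} B∈))
    }
    where
    pairwise-laminar : ∀ {A B} → A ≡ ⊤ ⊎ Basic K A → B ≡ ⊤ ⊎ Basic K B → Laminar A B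
    pairwise-laminar (inj₁ refl)    _              = inj₂ (inj₁ SubsetP.⊆⊤)
    pairwise-laminar (inj₂ _)       (inj₁ refl)    = inj₁ SubsetP.⊆⊤
    pairwise-laminar (inj₂ basic-A) (inj₂ basic-B) = basic-laminar basic-A basic-B

  K-cluster : cl tree K ≡ true
  K-cluster = listed⁺ {Cs = clusters} {K} (there (here refl))

  cherry≡K : ∀ {C X} → cl tree C ≡ true → ∣ X ∣ ≡ 3 → ∣ C ∩ X ∣ ≡ 2 → C ≡ K
  cherry≡K {C} {X} treeC ∣X∣≡3 ∣C∩X∣≡2 with ∈-clusters⁻ {C} (listed⁻ {Cs = clusters} treeC)
  ... | inj₁ refl = case trans (sym ∣X∣≡3) (trans (cong ∣_∣ (sym (SubsetP.∩-identityˡ X))) ∣C∩X∣≡2) of λ ()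
  ... | inj₂ (inj₁ C≡K) = C≡K
  ... | inj₂ (inj₂ (i , refl)) = ⊥-elim (∣⁅i⁆∩X∣≢2 i X ∣C∩X∣≡2)

Compatible : Subset n → Subset n → Set
Compatible A B = Empty (A ∩ B) ⊎ Empty (A ∩ ∁ B) ⊎ Empty (∁ A ∩ B) ⊎ Empty (∁ A ∩ ∁ B)

compatible-comm : {A B : Subset n} → Compatible A B → Compatible B A
compatible-comm =
  [ inj₁ ∘′ Empty-∩-comm
  , [ inj₂ ∘′ inj₂ ∘′ inj₁ ∘′ Empty-∩-comm
    , [ inj₂ ∘′ inj₁ ∘′ Empty-∩-comm , inj₂ ∘′ inj₂ ∘′ inj₂ ∘′ Empty-∩-comm ]′ ]′ ]′

compatible-∁ˡ : {A B : Subset n} → Compatible A B → Compatible (∁ A) B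
compatible-∁ˡ {A = A} {B} (inj₁ A∩B=∅) =
  inj₂ (inj₂ (inj₁ (subst (λ Z → Empty (Z ∩ B)) (sym (∁-involutive A)) A∩B=∅)))
compatible-∁ˡ {A = A} {B} (inj₂ (inj₁ A∩∁B=∅)) =
  inj₂ (inj₂ (inj₂ (subst (λ Z → Empty (Z ∩ ∁ B)) (sym (∁-involutive A)) A∩∁B=∅)))
compatible-∁ˡ (inj₂ (inj₂ (inj₁ ∁A∩B=∅)))  = inj₁ ∁A∩B=∅
compatible-∁ˡ (inj₂ (inj₂ (inj₂ ∁A∩∁B=∅))) = inj₂ (inj₁ ∁A∩∁B=∅)

compatible-∁ʳ : {A B : Subset n} → Compatible A B → Compatible A (∁ B)
compatible-∁ʳ = compatible-comm ∘′ compatible-∁ˡ ∘′ compatible-comm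

laminar⇒compatible : {A B : Subset n} → Laminar A B → Compatible A B
laminar⇒compatible (inj₁ A⊆B) =
  inj₂ (inj₁ λ (i , i∈A∩∁B) → SubsetP.x∈∁p⇒x∉p (∈-∩⁻ʳ i∈A∩∁B) (A⊆B (∈-∩⁻ˡ i∈A∩∁B)))
laminar⇒compatible (inj₂ (inj₁ B⊆A)) =
  inj₂ (inj₂ (inj₁ λ (i , i∈∁A∩B) → SubsetP.x∈∁p⇒x∉p (∈-∩⁻ˡ i∈∁A∩B) (B⊆A (∈-∩⁻ʳ i∈∁A∩B))))
laminar⇒compatible (inj₂ (inj₂ A∩B=∅)) = inj₁ A∩B=∅

module OneSplit (K : Subset n) {k₀ k₁ : Fin n} (k₀∈K : k₀ ∈ K) (k₁∉K : k₁ ∉ K) where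

  sides : List (Subset n)
  sides = K ∷ singletons n

  splits : List (Subset n)
  splits = sides ++ map ∁ sides

  Split : Subset n → Set
  Split C = ∃ λ L → Basic K L × (C ≡ L ⊎ C ≡ ∁ L)

  ∈-sides⁻ : ∀ {C} → C ∈ˡ sides → Basic K C
  ∈-sides⁻ (here C≡K)               = inj₁ C≡K
  ∈-sides⁻ (there C∈singletons)     = inj₂ (∈-singletons⁻ C∈singletons)

  ∈-sides⁺ : ∀ {L} → Basic K L → L ∈ˡ sides
  ∈-sides⁺ (inj₁ refl)       = here refl
  ∈-sides⁺ (inj₂ (i , refl)) = there (⁅i⁆∈singletons i)

  ∈-splits⁻ : ∀ {C} → C ∈ˡ splits → Split C
  ∈-splits⁻ {C} C∈ with ∈-++⁻ sides C∈
  ... | inj₁ C∈sides = C , ∈-sides⁻ C∈sides , inj₁ refl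
  ... | inj₂ C∈∁sides with ∈-map⁻ ∁ C∈∁sides
  ...   | L , L∈sides , C≡∁L = L , ∈-sides⁻ L∈sides , inj₂ C≡∁L

  ∈-splits⁺ : ∀ {C} → Split C → C ∈ˡ splits
  ∈-splits⁺ (L , basic , inj₁ refl) = ∈-++⁺ˡ (∈-sides⁺ basic)
  ∈-splits⁺ (L , basic , inj₂ refl) = ∈-++⁺ʳ sides (∈-map⁺ ∁ (∈-sides⁺ basic))

  split-∁ : ∀ {C} → Split C → Split (∁ C)
  split-∁ (L , basic , inj₁ C≡L)  = L , basic , inj₂ (cong ∁ C≡L)
  split-∁ (L , basic , inj₂ C≡∁L) = L , basic , inj₁ (trans (cong ∁ C≡∁L) (∁-involutive L))

  basic-nonempty : ∀ {L} → Basic K L → Nonempty L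
  basic-nonempty (inj₁ refl)       = k₀ , k₀∈K
  basic-nonempty (inj₂ (i , refl)) = i , SubsetP.x∈⁅x⁆ i

  ∁basic-nonempty : ∀ {L} → Basic K L → Nonempty (∁ L)
  ∁basic-nonempty (inj₁ refl) = k₁ , SubsetP.x∉p⇒x∈∁p k₁∉K
  ∁basic-nonempty (inj₂ (i , refl)) with i FinP.≟ k₀
  ... | yes refl = k₁ , SubsetP.x∉p⇒x∈∁p λ k₁∈⁅i⁆ → k₁∉K (subst (_∈ K) (sym (SubsetP.x∈⁅y⁆⇒x≡y i k₁∈⁅i⁆)) k₀∈K)
  ... | no i≢k₀  = k₀ , SubsetP.x∉p⇒x∈∁p λ k₀∈⁅i⁆ → i≢k₀ (sym (SubsetP.x∈⁅y⁆⇒x≡y i k₀∈⁅i⁆))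

  split-nonempty : ∀ {C} → Split C → Nonempty C
  split-nonempty (L , basic , inj₁ refl) = basic-nonempty basic
  split-nonempty (L , basic , inj₂ refl) = ∁basic-nonempty basic

  splits-compatible : ∀ {A B} → Split A → Split B → Compatible A B
  splits-compatible (L , basic-L , inj₁ refl) (M , basic-M , inj₁ refl) =
    laminar⇒compatible (basic-laminar basic-L basic-M)
  splits-compatible (L , basic-L , inj₂ refl) (M , basic-M , inj₁ refl) =
    compatible-∁ˡ (laminar⇒compatible (basic-laminar basic-L basic-M))
  splits-compatible (L , basic-L , inj₁ refl) (M , basic-M , inj₂ refl) =
    compatible-∁ʳ (laminar⇒compatible (basic-laminar basic-L basic-M))
  splits-compatible (L , basic-L , inj₂ refl) (M , basic-M , inj₂ refl) =
    compatible-∁ˡ (compatible-∁ʳ (laminar⇒compatible (basic-laminar basic-L basic-M)))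

  split⁻ : ∀ {C} → listed splits C ≡ true → Split C
  split⁻ {C} e = ∈-splits⁻ (listed⁻ {Cs = splits} {C} e)

  split⁺ : ∀ {C} → Split C → listed splits C ≡ true
  split⁺ {C} split = listed⁺ {Cs = splits} {C} (∈-splits⁺ split)

  tree : Unrooted n
  tree = record
    { sp      = listed splits
    ; symm    = λ C → true⇔true⇒≡ (λ e → split⁺ (split-∁ (split⁻ e)))
                                  (λ e → split⁺ (subst Split (∁-involutive C) (split-∁ (split⁻ e))))
    ; nonempt = unlisted {Cs = splits} {⊥} λ ⊥∈ → case split-nonempty (∈-splits⁻ ⊥∈) of λ (_ , i∈⊥) → SubsetP.∉⊥ i∈⊥
    ; trivial = λ i → split⁺ (⁅ i ⁆ , inj₂ (i , refl) , inj₁ refl)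
    ; compat  = λ A B A∈ B∈ → splits-compatible (split⁻ A∈) (split⁻ B∈)
    }

  K-split : sp tree K ≡ true
  K-split = split⁺ (K , inj₁ refl , inj₁ refl)

  cherry-side : ∀ {C X} → sp tree C ≡ true → ∣ X ∣ ≡ 4 → ∣ C ∩ X ∣ ≡ 2 → C ≡ K ⊎ C ≡ ∁ K
  cherry-side {C} {X} treeC ∣X∣≡4 ∣C∩X∣≡2 with split⁻ {C} treeC
  ... | L , inj₁ refl , C≡K⊎C≡∁K = C≡K⊎C≡∁K
  ... | L , inj₂ (i , refl) , C≡⁅i⁆⊎C≡∁⁅i⁆ = ⊥-elim (∣⁅i⁆∩X∣≢2 i X (∣≡2-up-to-∁ ∣X∣≡4 C≡⁅i⁆⊎C≡∁⁅i⁆ ∣C∩X∣≡2))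

-- Counterexamples

module _ {e₀ e₁ e₂ : Fin n} (e₀≢e₁ : e₀ ≢ e₁) (e₁≢e₂ : e₁ ≢ e₂) where

  cherries-differ : ∀ {X} → ∣ pair e₀ e₁ ∩ X ∣ ≡ 2 → pair e₀ e₂ ∩ X ≢ pair e₀ e₁ ∩ X
  cherries-differ {X} ∣P∩X∣≡2 Q∩X≡P∩X = [ e₀≢e₁ ∘′ sym , e₁≢e₂ ]′ (∈-pair⁻ e₁∈Q)
    where
    e₁∈Q : e₁ ∈ pair e₀ e₂
    e₁∈Q = ∈-∩-≡ (sym Q∩X≡P∩X) (proj₂ (∣pair∩X∣≡2⇒⊆ {a = e₀} {e₁} {X} ∣P∩X∣≡2)) (∈-pairʳ {a = e₀})

module RootedCounterexample {e₀ e₁ e₂ : Fin n} (e₀≢e₁ : e₀ ≢ e₁) (e₀≢e₂ : e₀ ≢ e₂) (e₁≢e₂ : e₁ ≢ e₂) where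

  P Q : Subset n
  P = pair e₀ e₁
  Q = pair e₀ e₂

  module TP = OneCluster P e₀ ∈-pairˡ
  module TQ = OneCluster Q e₀ ∈-pairˡ
  -- ⊤ is a trivial cluster, so this is the star tree
  module TS = OneCluster ⊤ e₀ SubsetP.∈⊤

  star-unresolving : ∀ X → ∣ X ∣ ≡ 3 → resolvedIn (cl TS.tree) X ≡ false
  star-unresolving X ∣X∣≡3 = ¬-not (unresolved ∘′ resolved⇒cherry (cl TS.tree) X)
    where
    unresolved : ¬ (∃ λ C → cl TS.tree C ≡ true × ∣ C ∩ X ∣ ≡ 2)
    unresolved (C , TS-C , ∣C∩X∣≡2) with TS.cherry≡K {C} {X} TS-C ∣X∣≡3 ∣C∩X∣≡2
    ... | refl = case trans (sym ∣X∣≡3) (trans (cong ∣_∣ (sym (SubsetP.∩-identityˡ X))) ∣C∩X∣≡2) of λ ()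

  e₂∉P : e₂ ∉ P
  e₂∉P e₂∈P = [ e₀≢e₂ ∘′ sym , e₁≢e₂ ∘′ sym ]′ (∈-pair⁻ e₂∈P)

  TP≉star : ¬ (TP.tree ≈R TS.tree)
  TP≉star TP≈TS with TS.∈-clusters⁻ (listed⁻ {Cs = TS.clusters} (trans (sym (TP≈TS P)) TP.K-cluster))
  ... | inj₁ P≡⊤               = e₂∉P (subst (e₂ ∈_) (sym P≡⊤) SubsetP.∈⊤)
  ... | inj₂ (inj₁ P≡⊤)        = e₂∉P (subst (e₂ ∈_) (sym P≡⊤) SubsetP.∈⊤)
  ... | inj₂ (inj₂ (i , P≡⁅i⁆)) = pair≢⁅i⁆ e₀≢e₁ P≡⁅i⁆

  never-same : ∀ X → ∣ X ∣ ≡ 3 → sameTopology (cl TP.tree) (cl TQ.tree) X ≡ false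
  never-same X ∣X∣≡3 = ¬-not (different ∘′ sameTopology⇒cherry (cl TP.tree) (cl TQ.tree) X)
    where
    different : ¬ SameCherry (cl TP.tree) (cl TQ.tree) X
    different (C , C′ , TP-C , ∣C∩X∣≡2 , TQ-C′ , C′∩X≡C∩X)
      with TP.cherry≡K {C} {X} TP-C ∣X∣≡3 ∣C∩X∣≡2
         | TQ.cherry≡K {C′} {X} TQ-C′ ∣X∣≡3 (trans (cong ∣_∣ C′∩X≡C∩X) ∣C∩X∣≡2)
    ... | refl | refl = cherries-differ e₀≢e₁ e₁≢e₂ ∣C∩X∣≡2 C′∩X≡C∩X

  X₀ : Subset n
  X₀ = triple e₀ e₁ e₂

  ∣X₀∣≡3 : ∣ X₀ ∣ ≡ 3
  ∣X₀∣≡3 = ∣triple∣≡3 e₀≢e₁ (e₀≢e₂ ∘′ sym) (e₁≢e₂ ∘′ sym)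

  TP-resolves-X₀ : resolvedIn (cl TP.tree) X₀ ≡ true
  TP-resolves-X₀ = cherry⇒resolved (cl TP.tree) X₀ P TP.K-cluster
    (trans (cong ∣_∣ (pair∩≡pair {a = e₀} {e₁} (∈-∪⁺ˡ ∈-pairˡ) (∈-∪⁺ˡ ∈-pairʳ))) (∣pair∣≡2 e₀≢e₁))

  TQ-resolves-X₀ : resolvedIn (cl TQ.tree) X₀ ≡ true
  TQ-resolves-X₀ = cherry⇒resolved (cl TQ.tree) X₀ Q TQ.K-cluster
    (trans (cong ∣_∣ (pair∩≡pair {a = e₀} {e₂} (∈-∪⁺ˡ ∈-pairˡ) (∈-∪⁺ʳ (SubsetP.x∈⁅x⁆ e₂)))) (∣pair∣≡2 e₀≢e₂))

module UnrootedCounterexample {e₀ e₁ e₂ e₃ : Fin n}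
  (e₀≢e₁ : e₀ ≢ e₁) (e₀≢e₂ : e₀ ≢ e₂) (e₀≢e₃ : e₀ ≢ e₃) (e₁≢e₂ : e₁ ≢ e₂) (e₁≢e₃ : e₁ ≢ e₃) (e₂≢e₃ : e₂ ≢ e₃)
  where

  P Q : Subset n
  P = pair e₀ e₁
  Q = pair e₀ e₂

  e₂∉P : e₂ ∉ P
  e₂∉P e₂∈P = [ e₀≢e₂ ∘′ sym , e₁≢e₂ ∘′ sym ]′ (∈-pair⁻ e₂∈P)

  e₃∉P : e₃ ∉ P
  e₃∉P e₃∈P = [ e₀≢e₃ ∘′ sym , e₁≢e₃ ∘′ sym ]′ (∈-pair⁻ e₃∈P)

  e₁∉Q : e₁ ∉ Q
  e₁∉Q e₁∈Q = [ e₀≢e₁ ∘′ sym , e₁≢e₂ ]′ (∈-pair⁻ e₁∈Q)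

  module TP = OneSplit P ∈-pairˡ e₂∉P
  module TQ = OneSplit Q ∈-pairˡ e₁∉Q
  -- ⁅ e₀ ⁆ is a trivial split, so this is the star tree
  module TS = OneSplit ⁅ e₀ ⁆ (SubsetP.x∈⁅x⁆ e₀) (e₀≢e₁ ∘′ sym ∘′ SubsetP.x∈⁅y⁆⇒x≡y e₀)

  star-unresolving : ∀ X → ∣ X ∣ ≡ 4 → resolvedIn (sp TS.tree) X ≡ false
  star-unresolving X ∣X∣≡4 = ¬-not (unresolved ∘′ resolved⇒cherry (sp TS.tree) X)
    where
    unresolved : ¬ (∃ λ C → sp TS.tree C ≡ true × ∣ C ∩ X ∣ ≡ 2)
    unresolved (C , TS-C , ∣C∩X∣≡2) =
      ∣⁅i⁆∩X∣≢2 e₀ X (∣≡2-up-to-∁ ∣X∣≡4 (TS.cherry-side {C} {X} TS-C ∣X∣≡4 ∣C∩X∣≡2) ∣C∩X∣≡2)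

  star-split : ∀ {C} → sp TS.tree C ≡ true → ∃ λ i → C ≡ ⁅ i ⁆ ⊎ C ≡ ∁ ⁅ i ⁆
  star-split {C} TS-C with TS.split⁻ {C} TS-C
  ... | _ , inj₁ refl       , side = e₀ , side
  ... | _ , inj₂ (i , refl) , side = i , side

  P≢∁⁅i⁆ : ∀ {i} → P ≢ ∁ ⁅ i ⁆
  P≢∁⁅i⁆ {i} P≡∁⁅i⁆ = e₂≢e₃ (trans (≡i e₂∉P) (sym (≡i e₃∉P)))
    where
    ≡i : ∀ {x} → x ∉ P → x ≡ i
    ≡i x∉P = SubsetP.x∈⁅y⁆⇒x≡y i (SubsetP.x∉∁p⇒x∈p (x∉P ∘′ subst (_ ∈_) (sym P≡∁⁅i⁆)))

  TP≉star : ¬ (TP.tree ≈U TS.tree)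
  TP≉star TP≈TS with star-split {P} (trans (sym (TP≈TS P)) TP.K-split)
  ... | i , inj₁ P≡⁅i⁆  = pair≢⁅i⁆ e₀≢e₁ P≡⁅i⁆
  ... | i , inj₂ P≡∁⁅i⁆ = P≢∁⁅i⁆ P≡∁⁅i⁆

  never-same : ∀ X → ∣ X ∣ ≡ 4 → sameTopology (sp TP.tree) (sp TQ.tree) X ≡ false
  never-same X ∣X∣≡4 = ¬-not (different ∘′ sameTopology⇒cherry (sp TP.tree) (sp TQ.tree) X)
    where
    different : ¬ SameCherry (sp TP.tree) (sp TQ.tree) X
    different (C , C′ , TP-C , ∣C∩X∣≡2 , TQ-C′ , C′∩X≡C∩X)
      with TP.cherry-side {C} {X} TP-C ∣X∣≡4 ∣C∩X∣≡2
         | TQ.cherry-side {C′} {X} TQ-C′ ∣X∣≡4 (trans (cong ∣_∣ C′∩X≡C∩X) ∣C∩X∣≡2)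
    ... | C-side | C′-side with ∩-≡-up-to-∁ C-side C′-side C′∩X≡C∩X
    ...   | inj₁ Q∩X≡P∩X  = cherries-differ e₀≢e₁ e₁≢e₂ (∣≡2-up-to-∁ ∣X∣≡4 C-side ∣C∩X∣≡2) Q∩X≡P∩X
    ...   | inj₂ Q∩X≡∁P∩X = SubsetP.x∈∁p⇒x∉p (∈-∩-≡ Q∩X≡∁P∩X e₀∈X ∈-pairˡ) ∈-pairˡ
      where
      e₀∈X : e₀ ∈ X
      e₀∈X = proj₁ (∣pair∩X∣≡2⇒⊆ {a = e₀} {e₂}
                     (∣≡2-up-to-∁ ∣X∣≡4 C′-side (trans (cong ∣_∣ C′∩X≡C∩X) ∣C∩X∣≡2)))

  X₀ : Subset n
  X₀ = quad e₀ e₁ e₂ e₃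

  ∣X₀∣≡4 : ∣ X₀ ∣ ≡ 4
  ∣X₀∣≡4 = ∣quad∣≡4 e₀≢e₁ (e₀≢e₂ ∘′ sym) (e₁≢e₂ ∘′ sym) (e₀≢e₃ ∘′ sym) (e₁≢e₃ ∘′ sym) (e₂≢e₃ ∘′ sym)

  TP-resolves-X₀ : resolvedIn (sp TP.tree) X₀ ≡ true
  TP-resolves-X₀ = cherry⇒resolved (sp TP.tree) X₀ P TP.K-split
    (trans (cong ∣_∣ (pair∩≡pair {a = e₀} {e₁} (∈-∪⁺ˡ ∈-pairˡ) (∈-∪⁺ˡ ∈-pairʳ))) (∣pair∣≡2 e₀≢e₁))

  TQ-resolves-X₀ : resolvedIn (sp TQ.tree) X₀ ≡ true
  TQ-resolves-X₀ = cherry⇒resolved (sp TQ.tree) X₀ Q TQ.K-split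
    (trans (cong ∣_∣ (pair∩≡pair {a = e₀} {e₂} (∈-∪⁺ˡ ∈-pairˡ) (∈-∪⁺ʳ ∈-pairˡ))) (∣pair∣≡2 e₀≢e₂))

module Triplet (n : ℕ) = UnitDistance {n} cl 3 sameTopology-trans-rooted rooted-from-triplets
module Quartet (n : ℕ) = UnitDistance {n} sp 4 sameTopology-trans-unrooted unrooted-from-quartets

module RootedExample (m : ℕ) =
  RootedCounterexample {3 ℕ.+ m} {Fin.zero} {Fin.suc Fin.zero} {Fin.suc (Fin.suc Fin.zero)} (λ ()) (λ ()) (λ ())

module UnrootedExample (m : ℕ) =
  UnrootedCounterexample {4 ℕ.+ m} {Fin.zero} {Fin.suc Fin.zero} {Fin.suc (Fin.suc Fin.zero)}
                         {Fin.suc (Fin.suc (Fin.suc Fin.zero))} (λ ()) (λ ()) (λ ()) (λ ()) (λ ()) (λ ())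

triplet-not-distance₀ : ∀ {m} → ¬ IsDistanceMeasure (_≈R_ {3 ℕ.+ m}) (dTriplet 0ℚ)
triplet-not-distance₀ {m} = Triplet.¬isDistanceMeasure₀ _ TP.tree TS.tree star-unresolving TP≉star
  where open RootedExample m

triplet-not-metric : ∀ {m} p → p + p < 1ℚ → ¬ IsMetric (_≈R_ {3 ℕ.+ m}) (dTriplet p)
triplet-not-metric {m} p p+p<1 = Triplet.¬isMetric _ p TP.tree TS.tree TQ.tree p+p<1
  star-unresolving never-same X₀ ∣X₀∣≡3 TP-resolves-X₀ TQ-resolves-X₀
  where open RootedExample m

quartet-not-distance₀ : ∀ {m} → ¬ IsDistanceMeasure (_≈U_ {4 ℕ.+ m}) (dQuartet 0ℚ)
quartet-not-distance₀ {m} = Quartet.¬isDistanceMeasure₀ _ TP.tree TS.tree star-unresolving TP≉star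
  where open UnrootedExample m

quartet-not-metric : ∀ {m} p → p + p < 1ℚ → ¬ IsMetric (_≈U_ {4 ℕ.+ m}) (dQuartet p)
quartet-not-metric {m} p p+p<1 = Quartet.¬isMetric _ p TP.tree TS.tree TQ.tree p+p<1
  star-unresolving never-same X₀ ∣X₀∣≡4 TP-resolves-X₀ TQ-resolves-X₀
  where open UnrootedExample m

p+p<1 : ∀ {p} → p < ½ → p + p < 1ℚ
p+p<1 p<½ = ℚP.+-mono-< p<½ p<½

p<½⇒p≤1 : ∀ {p} → p < ½ → p ≤ 1ℚ
p<½⇒p≤1 p<½ = ℚP.≤-trans (ℚP.<⇒≤ p<½) (p≤p+q (ℚP.nonNegative⁻¹ ½))

reciprocal : ∀ p → 0ℚ < p → ∃ λ c → 0ℚ ≤ c × c * p ≡ 1ℚ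
reciprocal p 0<p = 1/ p , ℚP.nonNegative⁻¹ (1/ p) {{ℚP.pos⇒nonNeg (1/ p) {{ℚP.1/pos⇒pos p}}}} , ℚP.*-inverseˡ p
  where
  instance
    _ : Positive p
    _ = positive 0<p
    _ : NonZero p
    _ = ℚP.pos⇒nonZero p

theorem3 :
    -- (a) triplet distance on rooted phylogenies over [n], n ≥ 3
    ((∀ n → 3 ≤ℕ n → ¬ IsDistanceMeasure (_≈R_ {n}) (dTriplet 0ℚ))
     × (∀ n → 3 ≤ℕ n → ∀ p → 0ℚ < p → p < ½ →
          IsDistanceMeasure (_≈R_ {n}) (dTriplet p) × ¬ IsMetric (_≈R_ {n}) (dTriplet p))
     × (∀ n → 3 ≤ℕ n → ∀ p → ½ ≤ p → p ≤ 1ℚ → IsMetric (_≈R_ {n}) (dTriplet p))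
     × (∀ p → 0ℚ < p → p < ½ → ∃ λ c →
          ∀ n → 3 ≤ℕ n → NearMetricWith (_≈R_ {n}) (dTriplet p) c))
    ×
    -- (b) quartet distance on unrooted phylogenies over [n], n ≥ 4
    ((∀ n → 4 ≤ℕ n → ¬ IsDistanceMeasure (_≈U_ {n}) (dQuartet 0ℚ))
     × (∀ n → 4 ≤ℕ n → ∀ p → 0ℚ < p → p < ½ →
          IsDistanceMeasure (_≈U_ {n}) (dQuartet p) × ¬ IsMetric (_≈U_ {n}) (dQuartet p))
     × (∀ n → 4 ≤ℕ n → ∀ p → ½ ≤ p → p ≤ 1ℚ → IsMetric (_≈U_ {n}) (dQuartet p))
     × (∀ p → 0ℚ < p → p < ½ → ∃ λ c →
          ∀ n → 4 ≤ℕ n → NearMetricWith (_≈U_ {n}) (dQuartet p) c))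
theorem3 =
  ( (λ { _ (ℕ.s≤s (ℕ.s≤s (ℕ.s≤s _))) → triplet-not-distance₀ })
  , (λ { _ (ℕ.s≤s (ℕ.s≤s (ℕ.s≤s _))) p 0<p p<½ →
         Triplet.isDistanceMeasure _ 0<p , triplet-not-metric p (p+p<1 p<½) })
  , (λ n _ p ½≤p _ → Triplet.isMetric n ½≤p)
  , λ p 0<p p<½ → case reciprocal p 0<p of λ
      { (c , 0≤c , c*p≡1) → c , λ n _ → Triplet.isNearMetric n 0<p (p<½⇒p≤1 p<½) 0≤c c*p≡1 } )
  , ( (λ { _ (ℕ.s≤s (ℕ.s≤s (ℕ.s≤s (ℕ.s≤s _)))) → quartet-not-distance₀ })
    , (λ { _ (ℕ.s≤s (ℕ.s≤s (ℕ.s≤s (ℕ.s≤s _)))) p 0<p p<½ →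
           Quartet.isDistanceMeasure _ 0<p , quartet-not-metric p (p+p<1 p<½) })
    , (λ n _ p ½≤p _ → Quartet.isMetric n ½≤p)
    , λ p 0<p p<½ → case reciprocal p 0<p of λ
        { (c , 0≤c , c*p≡1) → c , λ n _ → Quartet.isNearMetric n 0<p (p<½⇒p≤1 p<½) 0≤c c*p≡1 } )
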